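{- For all positive integers $n,m$ we have $r_{n,m}=c_{n,m}=k_{n,m}=b_{n,m}=s_{n,m}$.
   Context: RK puzzles: for a positive integer $n$ let $I_n=\{1,\dots,n\}$ and $I_{n,m}=I_n\times I_m\subset\mathbb{R}^2$ (first coordinate horizontal). For a slope $s\in\mathbb{Q}\cup\{\infty\}$ let $\mathscr{L}_s$ be the set of lines of slope $s$ meeting $I_{n,m}$, and for $\ell\in\mathscr{L}_s$ let $P_{\ell,s}(X)=\sum_{(i,j)\in\ell\cap I_{n,m}}X_{i,j}$. An $n\times m$ RK puzzle with finite slope set $T$ is a system consisting of one equation $P_{\ell,t}(X)=c_{\ell,t}$ (arbitrary $c_{\ell,t}\in\mathbb{R}$) for each $t\in T$, $\ell\in\mathscr{L}_t$; solutions are real solutions; solvable means having a solution. A set of entries $X_{i,j}$ is uniquely solvable if all solutions agree on each of them. Slope order: $S=\mathbb{Z}\cup\{1/k:k\in\mathbb{Z}\}$ with $1/0:=\infty$, totally ordered by $0\prec\infty\prec-1\prec1\prec-\frac12\prec-2\prec\frac12\prec2\prec-\frac13\prec-3\prec\frac13\prec3\prec\cdots$ (after $0,\infty,-1,1$, for each $k=2,3,\dots$ in turn come $-\frac1k\prec-k\prec\frac1k\prec k$). For $s\in S$, $\mathrm{RK}^s_{n,m}$ is the family of all solvable $n\times m$ RK puzzles with slope set $\{t\in S:t\preceq s\}$. Rows, columns, border: the $j$-th row of $I_{n,m}$ is $I_n\times\{j\}$, the first and last rows being $j=1$ and $j=m$; the $i$-th column is $\{i\}\times I_m$, the first and last columns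 being $i=1$ and $i=n$. The border is $B_{n,m}=(\{1,n\}\times I_m)\cup(I_n\times\{1,m\})$. Invariants (smallest elements of $S$ with respect to $\prec$): $k_{n,m}$ is the smallest $s$ such that every RK puzzle in $\mathrm{RK}^s_{n,m}$ has a unique solution; $b_{n,m}$ is the smallest $s$ such that the entries on the border $B_{n,m}$ of every RK puzzle in $\mathrm{RK}^s_{n,m}$ are uniquely solvable; $r_{n,m}$ (resp. $c_{n,m}$) is the smallest $s$ such that for every RK puzzle in $\mathrm{RK}^{s}_{n,m}$, the first row or the last row (resp. the first column or the last column) is uniquely solvable; $s_{n,m}=\min\{r_{n,m},c_{n,m}\}$.
   Formalization: The unknowns $X_{i,j}$ and the constants $c_{\ell,t}$ of every RK puzzle are rational instead of real, so solutions and solvability are taken over ℚ. -}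

module Defs where

open import Data.Nat using (ℕ; zero; suc; _≤_; _≤ᵇ_)
open import Data.Integer as ℤ using (ℤ; +_; -_)
open import Data.Rational using (ℚ; 0ℚ; _+_)
open import Data.Fin using (Fin; toℕ)
open import Data.Product using (Σ; ∃; _×_)
open import Data.Sum using (_⊎_)
open import Data.Bool using (if_then_else_)
open import Relation.Nullary.Decidable using (⌊_⌋)
open import Relation.Binary.PropositionalEquality using (_≡_)

-- The slope set S = ℤ ∪ {1/k : k ∈ ℤ} (with 1/0 = ∞), each element once.
-- negInv k = -1/(k+2), negInt k = -(k+2), posInv k = 1/(k+2), posInt k = k+2.

data Slope : Set where
  zeroS infS negOne posOne : Slope
  negInv negInt posInv posInt : ℕ → Slope

-- position of a slope in the total order
--   0 ≺ ∞ ≺ -1 ≺ 1 ≺ -1/2 ≺ -2 ≺ 1/2 ≺ 2 ≺ -1/3 ≺ -3 ≺ 1/3 ≺ 3 ≺ ⋯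
rank : Slope → ℕ
rank zeroS = 0
rank infS = 1
rank negOne = 2
rank posOne = 3
rank (negInv k) = 4 Data.Nat.+ 4 Data.Nat.* k
rank (negInt k) = 5 Data.Nat.+ 4 Data.Nat.* k
rank (posInv k) = 6 Data.Nat.+ 4 Data.Nat.* k
rank (posInt k) = 7 Data.Nat.+ 4 Data.Nat.* k

_⪯_ : Slope → Slope → Set
s ⪯ t = rank s ≤ rank t

minSlope : Slope → Slope → Slope
minSlope s t = if rank s ≤ᵇ rank t then s else t

dirX : Slope → ℤ
dirX zeroS = + 1
dirX infS = + 0
dirX negOne = + 1
dirX posOne = + 1
dirX (negInv k) = + (suc (suc k))
dirX (negInt k) = + 1
dirX (posInv k) = + (suc (suc k))
dirX (posInt k) = + 1

dirY : Slope → ℤ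
dirY zeroS = + 0
dirY infS = + 1
dirY negOne = - (+ 1)
dirY posOne = + 1
dirY (negInv k) = - (+ 1)
dirY (negInt k) = - (+ (suc (suc k)))
dirY (posInv k) = + 1
dirY (posInt k) = + (suc (suc k))

-- Two points lie on the same line
-- of slope t iff their labels agree.  (Grid points (i , j) ∈ I_{n,m} are
-- represented by (Fin n , Fin m) with i = toℕ i' + 1; the shift by 1 does
-- not affect which points share a line.)
label : ∀ {n m} → Slope → Fin n → Fin m → ℤ
label t i j = dirY t ℤ.* (+ toℕ i) ℤ.- dirX t ℤ.* (+ toℕ j)

∑ : ∀ {k} → (Fin k → ℚ) → ℚ
∑ {zero} f = 0ℚ
∑ {suc k} f = f Data.Fin.zero + ∑ (λ i → f (Data.Fin.suc i))

Assignment : ℕ → ℕ → Set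
Assignment n m = Fin n → Fin m → ℚ

lineSum : ∀ {n m} → Slope → ℤ → Assignment n m → ℚ
lineSum t d X = ∑ (λ i → ∑ (λ j → if ⌊ label t i j ℤ.≟ d ⌋ then X i j else 0ℚ))

-- right-hand sides c_{ℓ,t}, indexed by slope and line label
-- (values at labels of lines not meeting the grid are irrelevant)
Constants : Set
Constants = Slope → ℤ → ℚ

-- X solves the puzzle with slope set {t : t ⪯ s} and constants c:
-- for each slope t ⪯ s and each line ℓ of slope t meeting the grid
-- (ℓ = the line through some grid point (i , j)), P_{ℓ,t}(X) = c_{ℓ,t}.
IsSolution : (n m : ℕ) → Slope → Constants → Assignment n m → Set
IsSolution n m s c X =
  ∀ t → t ⪯ s → (i : Fin n) (j : Fin m) →
  lineSum t (label t i j) X ≡ c t (label t i j)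

Solvable : (n m : ℕ) → Slope → Constants → Set
Solvable n m s c = ∃ λ (X : Assignment n m) → IsSolution n m s c X

UniquelySolvable : (n m : ℕ) → Slope → Constants → (Fin n → Fin m → Set) → Set
UniquelySolvable n m s c A =
  ∀ X Y → IsSolution n m s c X → IsSolution n m s c Y →
  ∀ i j → A i j → X i j ≡ Y i j

allEntries firstRow lastRow firstCol lastCol border :
  ∀ {n m} → Fin n → Fin m → Set
allEntries i j = Data.Unit.⊤
  where import Data.Unit
firstRow i j = toℕ j ≡ 0
lastRow {m = m} i j = suc (toℕ j) ≡ m
firstCol i j = toℕ i ≡ 0
lastCol {n = n} i j = suc (toℕ i) ≡ n
border {n} {m} i j =
  (firstCol {n} {m} i j ⊎ lastCol {n} {m} i j) ⊎ (firstRow {n} {m} i j ⊎ lastRow {n} {m} i j)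

Kprop Bprop Rprop Cprop : ℕ → ℕ → Slope → Set
Kprop n m s = ∀ c → Solvable n m s c → UniquelySolvable n m s c allEntries
Bprop n m s = ∀ c → Solvable n m s c → UniquelySolvable n m s c border
Rprop n m s = ∀ c → Solvable n m s c →
  UniquelySolvable n m s c firstRow ⊎ UniquelySolvable n m s c lastRow
Cprop n m s = ∀ c → Solvable n m s c →
  UniquelySolvable n m s c firstCol ⊎ UniquelySolvable n m s c lastCol

IsLeast : (Slope → Set) → Slope → Set
IsLeast P s = P s × (∀ t → P t → s ⪯ t)

-- Write (a_t, b_t) = (run t, ±rise t) for the primitive direction vector of the slope t, and
-- let θ be the least slope s with n ≤ Σ_{t ⪯ s} run t or m ≤ Σ_{t ⪯ s} rise t.
--
-- At θ every puzzle is uniquely solvable: the difference Z of two solutions has zero line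
-- sums for all t ⪯ θ. If Z ≠ 0, then for each t the line of slope t through a point of the
-- support minimising b_t x − a_t y meets the support in a second point, at least run t to the
-- side; these lowest edges lie on the lower convex hull of the support, so edges of distinct
-- slopes project to non-overlapping intervals of [0, n − 1], giving Σ run t ≤ n − 1. By
-- transposition also Σ rise t ≤ m − 1, contradicting the choice of θ.
--
-- Below θ the entries of the first and of the last row are not determined: the coefficients
-- of ∏_{t ⪯ s} (x^{run t} y^{rise⁺ t} − y^{rise⁻ t}) fit into the grid, have zero line sums
-- for every t ⪯ s, and are nonzero somewhere in the bottom row of their box and (by the
-- half-turn symmetry of the product) somewhere in its top row. Transposing handles columns.
-- Since "all entries" ⇒ "border" ⇒ "first row", "first column", the four least slopes
-- all coincide with θ.
module Submission where

open import Algebra.Bundles using (AbelianGroup; CommutativeMonoid)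
open import Data.Bool using (true; false; if_then_else_)
open import Data.Empty using (⊥-elim)
open import Data.Fin as Fin using (Fin; toℕ) renaming (zero to fzero; suc to fsuc)
import Data.Fin.Properties as FinP
open import Data.Integer as ℤ using (ℤ; +_; -[1+_]; 0ℤ)
import Data.Integer.Properties as ℤP
open import Data.Integer.Tactic.RingSolver using (solve-∀)
open import Data.List using (List; []; _∷_; map; length; filter; cartesianProduct; allFin)
import Data.List.Properties as LP
open import Data.List.Extrema ℤP.≤-totalOrder using (argmin; argmin-all; f[argmin]≤f[xs])
open import Data.List.Membership.Propositional using (_∈_)
open import Data.List.Membership.Propositional.Properties using (∈-filter⁺; ∈-cartesianProduct⁺; ∈-allFin)
open import Data.List.Relation.Unary.All as All using (All; []; _∷_)
import Data.List.Relation.Unary.All.Properties as AllP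
open import Data.List.Relation.Unary.AllPairs as AP using (AllPairs; []; _∷_)
import Data.List.Relation.Unary.AllPairs.Properties as APP
open import Data.List.Relation.Unary.Any using (here; there)
open import Data.List.Relation.Unary.Unique.Propositional using (Unique)
import Data.List.Relation.Unary.Unique.Propositional.Properties as UniqueP
open import Data.Nat as ℕ using (ℕ; zero; suc; z≤n; s≤s; _≤_; _<_; _∸_)
import Data.Nat.Coprimality as Coprime
open import Data.Nat.ListAction using (sum)
import Data.Nat.Properties as ℕP
open import Data.Nat.Tactic.RingSolver using () renaming (solve-∀ to solve-∀ℕ)
open import Data.Product using (∃; ∃₂; _×_; _,_; proj₁; proj₂)
open import Data.Rational as ℚ using (ℚ; mkℚ; 0ℚ; 1ℚ)
import Data.Rational.Properties as ℚP
open import Data.Sum using (_⊎_; inj₁; inj₂; [_,_]′)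
open import Function using (_∘_)
open import Relation.Binary.PropositionalEquality
open import Relation.Nullary using (¬_; Dec; yes; no; does; ¬?; _⊎-dec_)
open import Relation.Nullary.Decidable using (⌊_⌋; decidable-stable)

open import Defs

import Algebra.Properties.CommutativeSemigroup
module ℕ+ = Algebra.Properties.CommutativeSemigroup ℕP.+-commutativeSemigroup
module ℚ+ = Algebra.Properties.CommutativeSemigroup
  (CommutativeMonoid.commutativeSemigroup ℚP.+-0-commutativeMonoid)
open import Algebra.Properties.Group (AbelianGroup.group ℚP.+-0-abelianGroup)
  using () renaming (x∙y⁻¹≈ε⇒x≈y to x-y≡0⇒x≡y; ⁻¹-involutive to neg-involutive)
open import Algebra.Properties.AbelianGroup ℚP.+-0-abelianGroup
  using () renaming (⁻¹-anti-homo‿- to neg-[x-y]≡y-x)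

run rise : Slope → ℕ
run t = ℤ.∣ dirX t ∣
rise t = ℤ.∣ dirY t ∣

dirX≡run : ∀ t → dirX t ≡ + run t
dirX≡run zeroS = refl
dirX≡run infS = refl
dirX≡run negOne = refl
dirX≡run posOne = refl
dirX≡run (negInv k) = refl
dirX≡run (negInt k) = refl
dirX≡run (posInv k) = refl
dirX≡run (posInt k) = refl

run+rise≥1 : ∀ t → 1 ≤ run t ℕ.+ rise t
run+rise≥1 zeroS = s≤s z≤n
run+rise≥1 infS = s≤s z≤n
run+rise≥1 negOne = s≤s z≤n
run+rise≥1 posOne = s≤s z≤n
run+rise≥1 (negInv k) = s≤s z≤n
run+rise≥1 (negInt k) = s≤s z≤n
run+rise≥1 (posInv k) = s≤s z≤n
run+rise≥1 (posInt k) = s≤s z≤n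

runs rises : List Slope → ℕ
runs ts = sum (map run ts)
rises ts = sum (map rise ts)

next : Slope → Slope
next zeroS = negInv 0
next infS = negInt 0
next negOne = posInv 0
next posOne = posInt 0
next (negInv k) = negInv (suc k)
next (negInt k) = negInt (suc k)
next (posInv k) = posInv (suc k)
next (posInt k) = posInt (suc k)

rank-next : ∀ t → rank (next t) ≡ 4 ℕ.+ rank t
rank-next zeroS = refl
rank-next infS = refl
rank-next negOne = refl
rank-next posOne = refl
rank-next (negInv k) = cong (4 ℕ.+_) (ℕP.*-suc 4 k)
rank-next (negInt k) = cong (5 ℕ.+_) (ℕP.*-suc 4 k)
rank-next (posInv k) = cong (6 ℕ.+_) (ℕP.*-suc 4 k)
rank-next (posInt k) = cong (7 ℕ.+_) (ℕP.*-suc 4 k)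

fromRank : ℕ → Slope
fromRank 0 = zeroS
fromRank 1 = infS
fromRank 2 = negOne
fromRank 3 = posOne
fromRank (suc (suc (suc (suc r)))) = next (fromRank r)

rank-fromRank : ∀ r → rank (fromRank r) ≡ r
rank-fromRank 0 = refl
rank-fromRank 1 = refl
rank-fromRank 2 = refl
rank-fromRank 3 = refl
rank-fromRank (suc (suc (suc (suc r)))) =
  trans (rank-next (fromRank r)) (cong (4 ℕ.+_) (rank-fromRank r))

fromRank-rank-next : ∀ t → fromRank (rank t) ≡ t → fromRank (rank (next t)) ≡ next t
fromRank-rank-next t eq = trans (cong fromRank (rank-next t)) (cong next eq)

fromRank-rank : ∀ t → fromRank (rank t) ≡ t
fromRank-rank zeroS = refl
fromRank-rank infS = refl
fromRank-rank negOne = refl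
fromRank-rank posOne = refl
fromRank-rank (negInv zero) = refl
fromRank-rank (negInt zero) = refl
fromRank-rank (posInv zero) = refl
fromRank-rank (posInt zero) = refl
fromRank-rank (negInv (suc k)) = fromRank-rank-next (negInv k) (fromRank-rank (negInv k))
fromRank-rank (negInt (suc k)) = fromRank-rank-next (negInt k) (fromRank-rank (negInt k))
fromRank-rank (posInv (suc k)) = fromRank-rank-next (posInv k) (fromRank-rank (posInv k))
fromRank-rank (posInt (suc k)) = fromRank-rank-next (posInt k) (fromRank-rank (posInt k))

slopesBelow : ℕ → List Slope
slopesBelow zero = []
slopesBelow (suc r) = fromRank r ∷ slopesBelow r

slopesUpTo : Slope → List Slope
slopesUpTo s = slopesBelow (suc (rank s))

slopesBelow-rank : ∀ r → All (λ t → rank t < r) (slopesBelow r)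
slopesBelow-rank zero = []
slopesBelow-rank (suc r) =
  ℕP.≤-reflexive (cong suc (rank-fromRank r)) ∷ All.map ℕP.m≤n⇒m≤1+n (slopesBelow-rank r)

slopesBelow-unique : ∀ r → Unique (slopesBelow r)
slopesBelow-unique zero = []
slopesBelow-unique (suc r) =
  All.map (λ t<r r≡t → ℕP.<-irrefl (trans (cong rank (sym r≡t)) (rank-fromRank r)) t<r)
          (slopesBelow-rank r)
  ∷ slopesBelow-unique r

∈-slopesBelow : ∀ {r t} → rank t < r → t ∈ slopesBelow r
∈-slopesBelow {suc r} {t} t<1+r with rank t ℕP.≟ r
... | yes refl = here (sym (fromRank-rank t))
... | no t≢r = there (∈-slopesBelow (ℕP.≤∧≢⇒< (ℕP.≤-pred t<1+r) t≢r))

∈-slopesUpTo : ∀ {s t} → t ⪯ s → t ∈ slopesUpTo s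
∈-slopesUpTo t⪯s = ∈-slopesBelow (s≤s t⪯s)

runs+rises-slopesBelow : ∀ r → r ≤ runs (slopesBelow r) ℕ.+ rises (slopesBelow r)
runs+rises-slopesBelow zero = z≤n
runs+rises-slopesBelow (suc r) = begin
  suc r                                ≤⟨ ℕP.+-mono-≤ (run+rise≥1 t) (runs+rises-slopesBelow r) ⟩
  (run t ℕ.+ rise t) ℕ.+ (runs ts ℕ.+ rises ts) ≡⟨ ℕ+.interchange (run t) (rise t) (runs ts) (rises ts) ⟩
  (run t ℕ.+ runs ts) ℕ.+ (rise t ℕ.+ rises ts) ∎
  where
  open ℕP.≤-Reasoning
  t = fromRank r
  ts = slopesBelow r

-- dirY t / dirX t in lowest terms; the value at ∞ is junk.
gradient : Slope → ℚ
gradient zeroS = mkℚ (+ 0) 0 (Coprime.sym (Coprime.1-coprimeTo 0))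
gradient infS = mkℚ (+ 0) 0 (Coprime.sym (Coprime.1-coprimeTo 0))
gradient negOne = mkℚ -[1+ 0 ] 0 (Coprime.1-coprimeTo 1)
gradient posOne = mkℚ (+ 1) 0 (Coprime.1-coprimeTo 1)
gradient (negInv k) = mkℚ -[1+ 0 ] (suc k) (Coprime.1-coprimeTo _)
gradient (negInt k) = mkℚ -[1+ suc k ] 0 (Coprime.sym (Coprime.1-coprimeTo _))
gradient (posInv k) = mkℚ (+ 1) (suc k) (Coprime.1-coprimeTo _)
gradient (posInt k) = mkℚ (+ suc (suc k)) 0 (Coprime.sym (Coprime.1-coprimeTo _))

fromGradient : ℚ → Slope
fromGradient (mkℚ (+ 0) _ _) = zeroS
fromGradient (mkℚ (+ 1) 0 _) = posOne
fromGradient (mkℚ (+ 1) (suc k) _) = posInv k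
fromGradient (mkℚ (+ suc (suc k)) 0 _) = posInt k
fromGradient (mkℚ -[1+ 0 ] 0 _) = negOne
fromGradient (mkℚ -[1+ 0 ] (suc k) _) = negInv k
fromGradient (mkℚ -[1+ suc k ] 0 _) = negInt k
fromGradient _ = infS

gradient-spec : ∀ t → t ≡ infS ⊎
  (ℚ.numerator (gradient t) ≡ dirY t × ℚ.denominator (gradient t) ≡ dirX t ×
   fromGradient (gradient t) ≡ t)
gradient-spec zeroS = inj₂ (refl , refl , refl)
gradient-spec infS = inj₁ refl
gradient-spec negOne = inj₂ (refl , refl , refl)
gradient-spec posOne = inj₂ (refl , refl , refl)
gradient-spec (negInv k) = inj₂ (refl , refl , refl)
gradient-spec (negInt k) = inj₂ (refl , refl , refl)
gradient-spec (posInv k) = inj₂ (refl , refl , refl)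
gradient-spec (posInt k) = inj₂ (refl , refl , refl)

dirX≡0⇒infS : ∀ t → dirX t ≡ 0ℤ → t ≡ infS
dirX≡0⇒infS zeroS ()
dirX≡0⇒infS infS _ = refl
dirX≡0⇒infS negOne ()
dirX≡0⇒infS posOne ()
dirX≡0⇒infS (negInv k) ()
dirX≡0⇒infS (negInt k) ()
dirX≡0⇒infS (posInv k) ()
dirX≡0⇒infS (posInt k) ()

parallel⇒≡ : ∀ t t' → dirY t ℤ.* dirX t' ≡ dirY t' ℤ.* dirX t → t ≡ t'
parallel⇒≡ t t' eq with gradient-spec t | gradient-spec t'
... | inj₁ refl | _ =
  sym (dirX≡0⇒infS t' (trans (sym (ℤP.*-identityˡ (dirX t'))) (trans eq (ℤP.*-zeroʳ (dirY t')))))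
... | inj₂ _ | inj₁ refl =
  dirX≡0⇒infS t (trans (sym (ℤP.*-identityˡ (dirX t))) (trans (sym eq) (ℤP.*-zeroʳ (dirY t))))
... | inj₂ (↥t , ↧t , t≡) | inj₂ (↥t' , ↧t' , t'≡) = begin
  t                          ≡⟨ sym t≡ ⟩
  fromGradient (gradient t)  ≡⟨ cong fromGradient (ℚP.≃⇒≡ (ℚ.*≡* cross)) ⟩
  fromGradient (gradient t') ≡⟨ t'≡ ⟩
  t'                         ∎
  where
  open ≡-Reasoning
  cross : ℚ.numerator (gradient t) ℤ.* ℚ.denominator (gradient t')
        ≡ ℚ.numerator (gradient t') ℤ.* ℚ.denominator (gradient t)
  cross = trans (cong₂ ℤ._*_ ↥t ↧t') (trans eq (sym (cong₂ ℤ._*_ ↥t' ↧t)))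

∑-cong : ∀ {k} {f g : Fin k → ℚ} → (∀ i → f i ≡ g i) → ∑ f ≡ ∑ g
∑-cong {zero} f≗g = refl
∑-cong {suc k} f≗g = cong₂ ℚ._+_ (f≗g fzero) (∑-cong (f≗g ∘ fsuc))

∑-zero : ∀ {k} {f : Fin k → ℚ} → (∀ i → f i ≡ 0ℚ) → ∑ f ≡ 0ℚ
∑-zero {zero} f≗0 = refl
∑-zero {suc k} f≗0 = cong₂ ℚ._+_ (f≗0 fzero) (∑-zero (f≗0 ∘ fsuc))

∑-distrib-+ : ∀ {k} (f g : Fin k → ℚ) → ∑ (λ i → f i ℚ.+ g i) ≡ ∑ f ℚ.+ ∑ g
∑-distrib-+ {zero} f g = refl
∑-distrib-+ {suc k} f g = trans (cong (f fzero ℚ.+ g fzero ℚ.+_) (∑-distrib-+ (f ∘ fsuc) (g ∘ fsuc)))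
                        (ℚ+.interchange (f fzero) (g fzero) (∑ (f ∘ fsuc)) (∑ (g ∘ fsuc)))

sub-interchange : ∀ a b c d → (a ℚ.- b) ℚ.+ (c ℚ.- d) ≡ (a ℚ.+ c) ℚ.- (b ℚ.+ d)
sub-interchange a b c d =
  trans (ℚ+.interchange a (ℚ.- b) c (ℚ.- d)) (cong (a ℚ.+ c ℚ.+_) (sym (ℚP.neg-distrib-+ b d)))

∑-distrib-sub : ∀ {k} (f g : Fin k → ℚ) → ∑ (λ i → f i ℚ.- g i) ≡ ∑ f ℚ.- ∑ g
∑-distrib-sub {zero} f g = refl
∑-distrib-sub {suc k} f g = trans (cong (f fzero ℚ.- g fzero ℚ.+_) (∑-distrib-sub (f ∘ fsuc) (g ∘ fsuc)))
                        (sub-interchange (f fzero) (g fzero) (∑ (f ∘ fsuc)) (∑ (g ∘ fsuc)))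

∑-comm : ∀ {k l} (f : Fin k → Fin l → ℚ) → ∑ (λ i → ∑ (f i)) ≡ ∑ (λ j → ∑ (λ i → f i j))
∑-comm {zero} {l} f = sym (∑-zero {l} (λ _ → refl))
∑-comm {suc k} f = trans (cong (∑ (f fzero) ℚ.+_) (∑-comm (f ∘ fsuc)))
                         (sym (∑-distrib-+ (f fzero) (λ j → ∑ (λ i → f (fsuc i) j))))

∑-nonzero : ∀ {k} (f : Fin k → ℚ) → ∑ f ≢ 0ℚ → ∃ λ i → f i ≢ 0ℚ
∑-nonzero {zero} f ∑f≢0 = ⊥-elim (∑f≢0 refl)
∑-nonzero {suc k} f ∑f≢0 with f fzero ℚP.≟ 0ℚ
... | no f0≢0 = fzero , f0≢0
... | yes f0≡0 = let i , fi≢0 = ∑-nonzero (f ∘ fsuc) (∑f≢0 ∘ tail≡0) in fsuc i , fi≢0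
  where tail≡0 : ∑ (f ∘ fsuc) ≡ 0ℚ → ∑ f ≡ 0ℚ
        tail≡0 eq = cong₂ ℚ._+_ f0≡0 eq

∑-single : ∀ {k} (f : Fin k → ℚ) (i₀ : Fin k) → (∃ λ i → i ≢ i₀ × f i ≢ 0ℚ) ⊎ ∑ f ≡ f i₀
∑-single {suc k} f fzero with ∑ (f ∘ fsuc) ℚP.≟ 0ℚ
... | yes rest≡0 = inj₂ (trans (cong (f fzero ℚ.+_) rest≡0) (ℚP.+-identityʳ (f fzero)))
... | no rest≢0 = let i , fi≢0 = ∑-nonzero (f ∘ fsuc) rest≢0 in inj₁ (fsuc i , (λ ()) , fi≢0)
∑-single {suc k} f (fsuc i₀) with f fzero ℚP.≟ 0ℚ | ∑-single (f ∘ fsuc) i₀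
... | no f0≢0 | _ = inj₁ (fzero , (λ ()) , f0≢0)
... | yes _ | inj₁ (i , i≢i₀ , fi≢0) = inj₁ (fsuc i , i≢i₀ ∘ FinP.suc-injective , fi≢0)
... | yes f0≡0 | inj₂ rest≡ = inj₂ (trans (cong₂ ℚ._+_ f0≡0 rest≡) (ℚP.+-identityˡ _))

∑-split : ∀ a b (f : ℕ → ℚ) →
  ∑ {a ℕ.+ b} (f ∘ toℕ) ≡ ∑ {a} (f ∘ toℕ) ℚ.+ ∑ {b} (λ i → f (a ℕ.+ toℕ i))
∑-split zero b f = sym (ℚP.+-identityˡ _)
∑-split (suc a) b f = trans (cong (f 0 ℚ.+_) (∑-split a b (f ∘ suc)))
                            (sym (ℚP.+-assoc (f 0) _ _))

≢0-stable : ∀ {q : ℚ} → ¬ q ≢ 0ℚ → q ≡ 0ℚ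
≢0-stable {q} = decidable-stable (q ℚP.≟ 0ℚ)

∑-window : ∀ N u L (f : ℕ → ℚ) → u ℕ.+ L < N → (∀ i → f i ≢ 0ℚ → u ≤ i × i ≤ u ℕ.+ L) →
  ∑ {N} (f ∘ toℕ) ≡ ∑ {suc L} (λ i → f (u ℕ.+ toℕ i))
∑-window N u L f u+L<N support with ℕP.m≤n⇒∃[o]m+o≡n (subst (_≤ N) (sym (ℕP.+-suc u L)) u+L<N)
... | r , refl = begin
  ∑ {u ℕ.+ suc L ℕ.+ r} (f ∘ toℕ)
    ≡⟨ cong (λ k → ∑ {k} (f ∘ toℕ)) (ℕP.+-assoc u (suc L) r) ⟩
  ∑ {u ℕ.+ (suc L ℕ.+ r)} (f ∘ toℕ)
    ≡⟨ ∑-split u (suc L ℕ.+ r) f ⟩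
  ∑ {u} (f ∘ toℕ) ℚ.+ ∑ {suc L ℕ.+ r} (λ i → f (u ℕ.+ toℕ i))
    ≡⟨ cong₂ ℚ._+_ (∑-zero (λ i → ≢0-stable (before i ∘ support _))) (∑-split (suc L) r (λ k → f (u ℕ.+ k))) ⟩
  0ℚ ℚ.+ (window ℚ.+ ∑ {r} (λ i → f (u ℕ.+ (suc L ℕ.+ toℕ i))))
    ≡⟨ ℚP.+-identityˡ _ ⟩
  window ℚ.+ ∑ {r} (λ i → f (u ℕ.+ (suc L ℕ.+ toℕ i)))
    ≡⟨ cong (window ℚ.+_) (∑-zero (λ i → ≢0-stable (after i ∘ support _))) ⟩
  window ℚ.+ 0ℚ
    ≡⟨ ℚP.+-identityʳ window ⟩
  window ∎
  where
  open ≡-Reasoning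
  window = ∑ {suc L} (λ i → f (u ℕ.+ toℕ i))
  before : (i : Fin u) → ¬ (u ≤ toℕ i × toℕ i ≤ u ℕ.+ L)
  before i (u≤i , _) = ℕP.<⇒≱ (FinP.toℕ<n i) u≤i
  after : (i : Fin r) → ¬ (u ≤ u ℕ.+ (suc L ℕ.+ toℕ i) × u ℕ.+ (suc L ℕ.+ toℕ i) ≤ u ℕ.+ L)
  after i (_ , ≤u+L) = ℕP.<⇒≱ (ℕP.+-monoʳ-< u (ℕP.m≤m+n (suc L) (toℕ i))) ≤u+L

labelℤ : Slope → ℤ → ℤ → ℤ
labelℤ t x y = dirY t ℤ.* x ℤ.- dirX t ℤ.* y

⌊⌋-cong : ∀ {a b} {A : Set a} {B : Set b} → (A → B) → (B → A) →
  (a? : Dec A) (b? : Dec B) → ⌊ a? ⌋ ≡ ⌊ b? ⌋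
⌊⌋-cong A→B B→A (yes _) (yes _) = refl
⌊⌋-cong A→B B→A (no _) (no _) = refl
⌊⌋-cong A→B B→A (yes a) (no ¬b) = ⊥-elim (¬b (A→B a))
⌊⌋-cong A→B B→A (no ¬a) (yes b) = ⊥-elim (¬a (B→A b))

lineSum-cong : ∀ {n m} t d {X Y : Assignment n m} → (∀ i j → X i j ≡ Y i j) →
  lineSum t d X ≡ lineSum t d Y
lineSum-cong t d X≗Y =
  ∑-cong λ i → ∑-cong λ j → cong (λ v → if ⌊ label t i j ℤP.≟ d ⌋ then v else 0ℚ) (X≗Y i j)

lineSum-distrib-sub : ∀ {n m} t d (X Y : Assignment n m) →
  lineSum t d (λ i j → X i j ℚ.- Y i j) ≡ lineSum t d X ℚ.- lineSum t d Y
lineSum-distrib-sub {n} {m} t d X Y = begin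
  ∑ (λ i → ∑ (λ j → on i j (X i j ℚ.- Y i j)))
    ≡⟨ ∑-cong (λ i → ∑-cong (λ j → if-sub (⌊ label t i j ℤP.≟ d ⌋) (X i j) (Y i j))) ⟩
  ∑ (λ i → ∑ (λ j → on i j (X i j) ℚ.- on i j (Y i j)))
    ≡⟨ ∑-cong (λ i → ∑-distrib-sub (λ j → on i j (X i j)) (λ j → on i j (Y i j))) ⟩
  ∑ (λ i → ∑ (λ j → on i j (X i j)) ℚ.- ∑ (λ j → on i j (Y i j)))
    ≡⟨ ∑-distrib-sub (λ i → ∑ (λ j → on i j (X i j))) (λ i → ∑ (λ j → on i j (Y i j))) ⟩
  lineSum t d X ℚ.- lineSum t d Y ∎
  where
  open ≡-Reasoning
  on : Fin n → Fin m → ℚ → ℚ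
  on i j v = if ⌊ label t i j ℤP.≟ d ⌋ then v else 0ℚ
  if-sub : ∀ b x y → (if b then x ℚ.- y else 0ℚ) ≡ (if b then x else 0ℚ) ℚ.- (if b then y else 0ℚ)
  if-sub true x y = refl
  if-sub false x y = refl

Balanced : ∀ {n m} → Slope → Assignment n m → Set
Balanced {n} {m} t X = ∀ (i : Fin n) (j : Fin m) → lineSum t (label t i j) X ≡ 0ℚ

-- Transposing the grid turns the slope t into 1/t

reciprocal : Slope → Slope
reciprocal zeroS = infS
reciprocal infS = zeroS
reciprocal negOne = negOne
reciprocal posOne = posOne
reciprocal (negInv k) = negInt k
reciprocal (negInt k) = negInv k
reciprocal (posInv k) = posInt k
reciprocal (posInt k) = posInv k

reciprocal-involutive : ∀ t → reciprocal (reciprocal t) ≡ t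
reciprocal-involutive zeroS = refl
reciprocal-involutive infS = refl
reciprocal-involutive negOne = refl
reciprocal-involutive posOne = refl
reciprocal-involutive (negInv k) = refl
reciprocal-involutive (negInt k) = refl
reciprocal-involutive (posInv k) = refl
reciprocal-involutive (posInt k) = refl

dir-reciprocal : ∀ t →
  (dirX (reciprocal t) ≡ dirY t × dirY (reciprocal t) ≡ dirX t) ⊎
  (dirX (reciprocal t) ≡ ℤ.- dirY t × dirY (reciprocal t) ≡ ℤ.- dirX t)
dir-reciprocal zeroS = inj₁ (refl , refl)
dir-reciprocal infS = inj₁ (refl , refl)
dir-reciprocal negOne = inj₂ (refl , refl)
dir-reciprocal posOne = inj₁ (refl , refl)
dir-reciprocal (negInv k) = inj₂ (refl , refl)
dir-reciprocal (negInt k) = inj₂ (refl , refl)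
dir-reciprocal (posInv k) = inj₁ (refl , refl)
dir-reciprocal (posInt k) = inj₁ (refl , refl)

run-reciprocal : ∀ t → run (reciprocal t) ≡ rise t
run-reciprocal t with dir-reciprocal t
... | inj₁ (x≡ , _) = cong ℤ.∣_∣ x≡
... | inj₂ (x≡ , _) = trans (cong ℤ.∣_∣ x≡) (ℤP.∣-i∣≡∣i∣ (dirY t))

label-reciprocal : ∀ t →
  (∀ x y → labelℤ (reciprocal t) y x ≡ ℤ.- labelℤ t x y) ⊎
  (∀ x y → labelℤ (reciprocal t) y x ≡ labelℤ t x y)
label-reciprocal t with dir-reciprocal t
... | inj₁ (x≡ , y≡) = inj₁ λ x y → begin
  dirY (reciprocal t) ℤ.* y ℤ.- dirX (reciprocal t) ℤ.* x ≡⟨ cong₂ (λ a b → a ℤ.* y ℤ.- b ℤ.* x) y≡ x≡ ⟩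
  dirX t ℤ.* y ℤ.- dirY t ℤ.* x                           ≡⟨ swap (dirX t) (dirY t) x y ⟩
  ℤ.- labelℤ t x y ∎
  where
  open ≡-Reasoning
  swap : ∀ a b x y → a ℤ.* y ℤ.- b ℤ.* x ≡ ℤ.- (b ℤ.* x ℤ.- a ℤ.* y)
  swap = solve-∀
... | inj₂ (x≡ , y≡) = inj₂ λ x y → begin
  dirY (reciprocal t) ℤ.* y ℤ.- dirX (reciprocal t) ℤ.* x ≡⟨ cong₂ (λ a b → a ℤ.* y ℤ.- b ℤ.* x) y≡ x≡ ⟩
  ℤ.- dirX t ℤ.* y ℤ.- ℤ.- dirY t ℤ.* x                   ≡⟨ swap (dirX t) (dirY t) x y ⟩
  labelℤ t x y ∎
  where
  open ≡-Reasoning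
  swap : ∀ a b x y → ℤ.- a ℤ.* y ℤ.- ℤ.- b ℤ.* x ≡ b ℤ.* x ℤ.- a ℤ.* y
  swap = solve-∀

sameLine-reciprocal : ∀ t x y x' y' →
  ⌊ labelℤ (reciprocal t) y' x' ℤP.≟ labelℤ (reciprocal t) y x ⌋ ≡ ⌊ labelℤ t x' y' ℤP.≟ labelℤ t x y ⌋
sameLine-reciprocal t x y x' y' with label-reciprocal t
... | inj₁ neg = ⌊⌋-cong (λ eq → ℤP.neg-injective (trans (sym (neg x' y')) (trans eq (neg x y))))
                         (λ eq → trans (neg x' y') (trans (cong ℤ.-_ eq) (sym (neg x y)))) _ _
... | inj₂ same = ⌊⌋-cong (λ eq → trans (sym (same x' y')) (trans eq (same x y)))
                          (λ eq → trans (same x' y') (trans eq (sym (same x y)))) _ _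

transpose : ∀ {n m} → Assignment n m → Assignment m n
transpose X j i = X i j


lineSum-transpose : ∀ {n m} t (X : Assignment n m) (i : Fin n) (j : Fin m) →
  lineSum (reciprocal t) (label (reciprocal t) j i) (transpose X) ≡ lineSum t (label t i j) X
lineSum-transpose {n} {m} t X i j =
  trans (∑-comm {m} {n} _) (∑-cong λ i' → ∑-cong λ j' →
    cong (λ b → if b then X i' j' else 0ℚ)
         (sameLine-reciprocal t (+ toℕ i) (+ toℕ j) (+ toℕ i') (+ toℕ j')))

Balanced-transpose : ∀ {n m} t {X : Assignment n m} → Balanced t X → Balanced (reciprocal t) (transpose X)
Balanced-transpose t {X} bal j i = trans (lineSum-transpose t X i j) (bal i j)

-- Uniqueness at saturation: lowest edges of a kernel element

module _ {A : Set} (start len : A → ℕ) where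

  Apart : A → A → Set
  Apart a b = start a ℕ.+ len a ≤ start b ⊎ start b ℕ.+ len b ≤ start a

  private
    endsBy : ∀ c a → Dec (start a ℕ.+ len a ≤ c)
    endsBy c a = start a ℕ.+ len a ℕP.≤? c

    sum-partition : ∀ c xs → sum (map len xs) ≡
      sum (map len (filter (endsBy c) xs)) ℕ.+ sum (map len (filter (¬? ∘ endsBy c) xs))
    sum-partition c [] = refl
    sum-partition c (a ∷ xs) with does (endsBy c a)
    ... | true = trans (cong (len a ℕ.+_) (sum-partition c xs)) (sym (ℕP.+-assoc (len a) _ _))
    ... | false = trans (cong (len a ℕ.+_) (sum-partition c xs)) 
        (ℕ+.x∙yz≈y∙xz (len a) (sum (map len (filter (endsBy c) xs)))
                            (sum (map len (filter (¬? ∘ endsBy c) xs))))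

  -- Fuel k bounds the length, since the recursion is on two filtered sublists.
  apart-packing : ∀ k (xs : List A) → length xs ≤ k → ∀ {lo hi} → lo ≤ hi → AllPairs Apart xs →
    All (λ a → lo ≤ start a × start a ℕ.+ len a ≤ hi) xs → lo ℕ.+ sum (map len xs) ≤ hi
  apart-packing k [] _ {lo} lo≤hi _ _ = ℕP.≤-trans (ℕP.≤-reflexive (ℕP.+-identityʳ lo)) lo≤hi
  apart-packing (suc k) (a ∷ xs) (s≤s len≤k) {lo} {hi} _ (a-apart ∷ apart) ((lo≤a , a≤hi) ∷ inside) = begin
    lo ℕ.+ (len a ℕ.+ sum (map len xs))   ≡⟨ cong (λ s → lo ℕ.+ (len a ℕ.+ s)) (sum-partition (start a) xs) ⟩
    lo ℕ.+ (len a ℕ.+ (sumˡ ℕ.+ sumʳ))    ≡⟨ rearrange lo (len a) sumˡ sumʳ ⟩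
    (lo ℕ.+ sumˡ) ℕ.+ len a ℕ.+ sumʳ      ≤⟨ ℕP.+-monoˡ-≤ sumʳ (ℕP.+-monoˡ-≤ (len a) left-packing) ⟩
    start a ℕ.+ len a ℕ.+ sumʳ            ≤⟨ right-packing ⟩
    hi                                    ∎
    where
    open ℕP.≤-Reasoning hiding (start)
    left = filter (endsBy (start a)) xs
    right = filter (¬? ∘ endsBy (start a)) xs
    sumˡ = sum (map len left)
    sumʳ = sum (map len right)
    rearrange : ∀ w x y z → w ℕ.+ (x ℕ.+ (y ℕ.+ z)) ≡ (w ℕ.+ y) ℕ.+ x ℕ.+ z
    rearrange = solve-∀ℕ
    left-packing : lo ℕ.+ sumˡ ≤ start a
    left-packing = apart-packing k left (ℕP.≤-trans (LP.length-filter _ xs) len≤k) lo≤a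
      (APP.filter⁺ _ apart)
      (All.zipWith (λ { ((lo≤b , _) , b≤a) → lo≤b , b≤a })
        (AllP.filter⁺ (endsBy (start a)) inside , AllP.all-filter (endsBy (start a)) xs))
    right-packing : start a ℕ.+ len a ℕ.+ sumʳ ≤ hi
    right-packing = apart-packing k right (ℕP.≤-trans (LP.length-filter _ xs) len≤k) a≤hi
      (APP.filter⁺ _ apart)
      (All.zipWith (λ { (((_ , b≤hi) , inj₁ a≤b) , _) → a≤b , b≤hi
                      ; (((_ , _) , inj₂ b≤a) , b≰a) → ⊥-elim (b≰a b≤a) })
        (AllP.filter⁺ (¬? ∘ endsBy (start a)) (All.zip (inside , a-apart)) ,
         AllP.all-filter (¬? ∘ endsBy (start a)) xs))

unimodular : ∀ t → dirX t ≡ + 1 ⊎ dirY t ℤ.* dirY t ≡ + 1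
unimodular zeroS = inj₁ refl
unimodular infS = inj₂ refl
unimodular negOne = inj₁ refl
unimodular posOne = inj₁ refl
unimodular (negInv k) = inj₂ refl
unimodular (negInt k) = inj₁ refl
unimodular (posInv k) = inj₂ refl
unimodular (posInt k) = inj₁ refl

multiple-of-direction : ∀ a b u v → a ≡ + 1 ⊎ b ℤ.* b ≡ + 1 → b ℤ.* u ≡ a ℤ.* v →
  ∃ λ k → u ≡ k ℤ.* a × v ≡ k ℤ.* b
multiple-of-direction .(+ 1) b u v (inj₁ refl) bu≡v = u , sym (ℤP.*-identityʳ u) ,
  trans (sym (ℤP.*-identityˡ v)) (trans (sym bu≡v) (ℤP.*-comm b u))
multiple-of-direction a b u v (inj₂ b²≡1) bu≡av = b ℤ.* v , u≡ , v≡
  where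
  open ≡-Reasoning
  u≡ : u ≡ b ℤ.* v ℤ.* a
  u≡ = begin
    u                   ≡⟨ sym (ℤP.*-identityˡ u) ⟩
    + 1 ℤ.* u           ≡⟨ cong (ℤ._* u) (sym b²≡1) ⟩
    b ℤ.* b ℤ.* u       ≡⟨ ℤP.*-assoc b b u ⟩
    b ℤ.* (b ℤ.* u)     ≡⟨ cong (b ℤ.*_) bu≡av ⟩
    b ℤ.* (a ℤ.* v)     ≡⟨ solve-∀′ b a v ⟩
    b ℤ.* v ℤ.* a       ∎
    where solve-∀′ : ∀ b a v → b ℤ.* (a ℤ.* v) ≡ b ℤ.* v ℤ.* a
          solve-∀′ = solve-∀
  v≡ : v ≡ b ℤ.* v ℤ.* b
  v≡ = begin
    v                   ≡⟨ sym (ℤP.*-identityˡ v) ⟩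
    + 1 ℤ.* v           ≡⟨ cong (ℤ._* v) (sym b²≡1) ⟩
    b ℤ.* b ℤ.* v       ≡⟨ solve-∀′ b v ⟩
    b ℤ.* v ℤ.* b       ∎
    where solve-∀′ : ∀ b v → b ℤ.* b ℤ.* v ≡ b ℤ.* v ℤ.* b
          solve-∀′ = solve-∀

sameLine⇒multiple : ∀ t x y x' y' → labelℤ t x y ≡ labelℤ t x' y' →
  ∃ λ k → x' ℤ.- x ≡ k ℤ.* dirX t × y' ℤ.- y ≡ k ℤ.* dirY t
sameLine⇒multiple t x y x' y' eq =
  multiple-of-direction (dirX t) (dirY t) (x' ℤ.- x) (y' ℤ.- y) (unimodular t) (begin
    dirY t ℤ.* (x' ℤ.- x)                                   ≡⟨ expand (dirY t) (dirX t) x y x' y' ⟩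
    labelℤ t x' y' ℤ.- labelℤ t x y ℤ.+ dirX t ℤ.* (y' ℤ.- y) ≡⟨ cong (λ l → l ℤ.- labelℤ t x y ℤ.+ dirX t ℤ.* (y' ℤ.- y)) (sym eq) ⟩
    labelℤ t x y ℤ.- labelℤ t x y ℤ.+ dirX t ℤ.* (y' ℤ.- y)  ≡⟨ cancel (labelℤ t x y) (dirX t ℤ.* (y' ℤ.- y)) ⟩
    dirX t ℤ.* (y' ℤ.- y)                                   ∎)
  where
  open ≡-Reasoning
  expand : ∀ b a x y x' y' →
    b ℤ.* (x' ℤ.- x) ≡ (b ℤ.* x' ℤ.- a ℤ.* y') ℤ.- (b ℤ.* x ℤ.- a ℤ.* y) ℤ.+ a ℤ.* (y' ℤ.- y)
  expand = solve-∀
  cancel : ∀ l r → l ℤ.- l ℤ.+ r ≡ r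
  cancel = solve-∀

x-a≡p⇒x≡a+p : ∀ x a p → x ℤ.- + a ≡ + p → x ≡ + (a ℕ.+ p)
x-a≡p⇒x≡a+p x a p eq = begin
  x                     ≡⟨ solve-∀′ x (+ a) ⟩
  + a ℤ.+ (x ℤ.- + a)   ≡⟨ cong (λ d → + a ℤ.+ d) eq ⟩
  + a ℤ.+ + p           ≡⟨ sym (ℤP.pos-+ a p) ⟩
  + (a ℕ.+ p)           ∎
  where
  open ≡-Reasoning
  solve-∀′ : ∀ x a → x ≡ a ℤ.+ (x ℤ.- a)
  solve-∀′ = solve-∀

[a+p]-a≡p : ∀ a p → + (a ℕ.+ p) ℤ.- + a ≡ + p
[a+p]-a≡p a p = begin
  + (a ℕ.+ p) ℤ.- + a    ≡⟨ cong (ℤ._- + a) (ℤP.pos-+ a p) ⟩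
  + a ℤ.+ + p ℤ.- + a    ≡⟨ cancel (+ a) (+ p) ⟩
  + p                    ∎
  where
  open ≡-Reasoning
  cancel : ∀ a p → a ℤ.+ p ℤ.- a ≡ p
  cancel = solve-∀

positive-step⇒run≤ : ∀ t x x' k → + x' ℤ.- + x ≡ + suc k ℤ.* dirX t → x ℕ.+ run t ≤ x'
positive-step⇒run≤ t x x' k Δx≡ = begin
  x ℕ.+ run t              ≤⟨ ℕP.+-monoʳ-≤ x (ℕP.m≤m+n (run t) (k ℕ.* run t)) ⟩
  x ℕ.+ suc k ℕ.* run t    ≡⟨ sym (ℤP.+-injective (x-a≡p⇒x≡a+p (+ x') x _ Δx≡')) ⟩
  x'                       ∎
  where
  open ℕP.≤-Reasoning
  Δx≡' : + x' ℤ.- + x ≡ + (suc k ℕ.* run t)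
  Δx≡' = trans Δx≡ (trans (cong ((+ suc k) ℤ.*_) (dirX≡run t)) (sym (ℤP.pos-* (suc k) (run t))))

sameLine-apart : ∀ t x y x' y' → labelℤ t (+ x) (+ y) ≡ labelℤ t (+ x') (+ y') → ¬ (x ≡ x' × y ≡ y') →
  x ℕ.+ run t ≤ x' ⊎ x' ℕ.+ run t ≤ x
sameLine-apart t x y x' y' eq distinct with sameLine⇒multiple t (+ x) (+ y) (+ x') (+ y') eq
... | + 0 , Δx≡ , Δy≡ = ⊥-elim (distinct (same Δx≡ , same Δy≡))
  where
  same : ∀ {u u'} → + u' ℤ.- + u ≡ + 0 → u ≡ u'
  same {u} {u'} Δ≡0 = sym (trans (ℤP.+-injective (x-a≡p⇒x≡a+p (+ u') u 0 Δ≡0)) (ℕP.+-identityʳ u))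
... | + suc k , Δx≡ , _ = inj₁ (positive-step⇒run≤ t x x' k Δx≡)
... | -[1+ k ] , Δx≡ , _ = inj₂ (positive-step⇒run≤ t x' x k (begin
  + x ℤ.- + x'                 ≡⟨ flip (+ x) (+ x') ⟩
  ℤ.- (+ x' ℤ.- + x)           ≡⟨ cong ℤ.-_ Δx≡ ⟩
  ℤ.- (-[1+ k ] ℤ.* dirX t)    ≡⟨ ℤP.neg-distribˡ-* -[1+ k ] (dirX t) ⟩
  + suc k ℤ.* dirX t           ∎))
  where
  open ≡-Reasoning
  flip : ∀ a b → a ℤ.- b ≡ ℤ.- (b ℤ.- a)
  flip = solve-∀

indicator≢0 : ∀ {a d : ℤ} v → (if ⌊ a ℤP.≟ d ⌋ then v else 0ℚ) ≢ 0ℚ → a ≡ d × v ≢ 0ℚ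
indicator≢0 {a} {d} v nz with a ℤP.≟ d
... | yes a≡d = a≡d , nz
... | no _ = ⊥-elim (nz refl)

indicator-refl : ∀ (d : ℤ) v → (if ⌊ d ℤP.≟ d ⌋ then v else 0ℚ) ≡ v
indicator-refl d v with d ℤP.≟ d
... | yes _ = refl
... | no d≢d = ⊥-elim (d≢d refl)

0≤dirX* : ∀ t {e} → 0ℤ ℤ.≤ e → 0ℤ ℤ.≤ dirX t ℤ.* e
0≤dirX* t {e} e≥0 rewrite dirX≡run t =
  subst (ℤ._≤ + run t ℤ.* e) (ℤP.*-zeroʳ (+ run t)) (ℤP.*-monoˡ-≤-nonNeg (+ run t) e≥0)

pred<n : ∀ {n} → Fin n → ℕ.pred n < n
pred<n {suc n} _ = ℕP.n<1+n n

module _ {n m : ℕ} (Z : Assignment n m) where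

  Point : Set
  Point = Fin n × Fin m

  col row : Point → ℕ
  col (i , _) = toℕ i
  row (_ , j) = toℕ j

  labelAt : Slope → Point → ℤ
  labelAt t (i , j) = label t i j

  Support : Point → Set
  Support (i , j) = Z i j ≢ 0ℚ

  private
    support? : ∀ p → Dec (Support p)
    support? (i , j) = ¬? (Z i j ℚP.≟ 0ℚ)

    supportList : List Point
    supportList = filter support? (cartesianProduct (allFin n) (allFin m))

    ∈-supportList : ∀ p → Support p → p ∈ supportList
    ∈-supportList (i , j) = ∈-filter⁺ support? (∈-cartesianProduct⁺ (∈-allFin i) (∈-allFin j))

    lineTerm : Slope → ℤ → Fin n → Fin m → ℚ
    lineTerm t d i j = if ⌊ label t i j ℤP.≟ d ⌋ then Z i j else 0ℚ

  lowest : Slope → Point → Point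
  lowest t p₀ = argmin (labelAt t) p₀ supportList

  lowest-support : ∀ t {p₀} → Support p₀ → Support (lowest t p₀)
  lowest-support t s₀ = argmin-all (labelAt t) s₀ (AllP.all-filter support? (cartesianProduct (allFin n) (allFin m)))

  lowest-min : ∀ t p₀ q → Support q → labelAt t (lowest t p₀) ℤ.≤ labelAt t q
  lowest-min t p₀ q sq = All.lookup (f[argmin]≤f[xs] {f = labelAt t} p₀ supportList) (∈-supportList q sq)

  partner : ∀ t → Balanced t Z → ∀ p → Support p →
    ∃ λ q → q ≢ p × Support q × labelAt t q ≡ labelAt t p
  partner t bal (i₀ , j₀) s₀ with ∑-single (λ i → ∑ (lineTerm t (label t i₀ j₀) i)) i₀
  ... | inj₁ (i , i≢i₀ , row≢0) =
    let j , nz = ∑-nonzero (lineTerm t (label t i₀ j₀) i) row≢0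
        eq , zij = indicator≢0 (Z i j) nz
    in (i , j) , i≢i₀ ∘ cong proj₁ , zij , eq
  ... | inj₂ sum≡row with ∑-single (lineTerm t (label t i₀ j₀) i₀) j₀
  ...   | inj₁ (j , j≢j₀ , nz) = let eq , zij = indicator≢0 (Z i₀ j) nz
                                 in (i₀ , j) , j≢j₀ ∘ cong proj₂ , zij , eq
  ...   | inj₂ row≡entry = ⊥-elim (s₀ (begin
    Z i₀ j₀                           ≡⟨ sym (indicator-refl (label t i₀ j₀) (Z i₀ j₀)) ⟩
    lineTerm t (label t i₀ j₀) i₀ j₀  ≡⟨ sym row≡entry ⟩
    ∑ (lineTerm t (label t i₀ j₀) i₀) ≡⟨ sym sum≡row ⟩
    lineSum t (label t i₀ j₀) Z       ≡⟨ bal i₀ j₀ ⟩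
    0ℚ                                ∎))
    where open ≡-Reasoning

  record Edge (t : Slope) : Set where
    field
      left right : Point
      left-support : Support left
      right-support : Support right
      same-line : labelAt t left ≡ labelAt t right
      left-lowest : ∀ q → Support q → labelAt t left ℤ.≤ labelAt t q
      wide : col left ℕ.+ run t ≤ col right

  edge : ∀ t → Balanced t Z → ∀ p₀ → Support p₀ → Edge t
  edge t bal p₀ s₀ = orient (sameLine-apart t (col P) (row P) (col Q) (row Q) (sym QP-line) P≢Q)
    where
    P = lowest t p₀
    sP = lowest-support t s₀
    Q = proj₁ (partner t bal P sP)
    Q≢P = proj₁ (proj₂ (partner t bal P sP))
    sQ = proj₁ (proj₂ (proj₂ (partner t bal P sP)))
    QP-line = proj₂ (proj₂ (proj₂ (partner t bal P sP)))
    P≢Q : ¬ (col P ≡ col Q × row P ≡ row Q)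
    P≢Q (c≡ , r≡) = Q≢P (sym (cong₂ _,_ (FinP.toℕ-injective c≡) (FinP.toℕ-injective r≡)))
    orient : col P ℕ.+ run t ≤ col Q ⊎ col Q ℕ.+ run t ≤ col P → Edge t
    orient (inj₁ wide) = record
      { left = P ; right = Q ; left-support = sP ; right-support = sQ
      ; same-line = sym QP-line ; left-lowest = lowest-min t p₀ ; wide = wide }
    orient (inj₂ wide) = record
      { left = Q ; right = P ; left-support = sQ ; right-support = sP
      ; same-line = QP-line
      ; left-lowest = λ q sq → subst (ℤ._≤ labelAt t q) (sym QP-line) (lowest-min t p₀ q sq)
      ; wide = wide }

  open Edge

  -- Convexity of the lower hull: an edge reaching past the start of another is no steeper
  -- (slopes compared by cross-multiplication, using run ≥ 0).
  edge-order : ∀ {t t'} (e : Edge t) (e' : Edge t') → col (left e') < col (right e) →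
    dirY t ℤ.* dirX t' ℤ.≤ dirY t' ℤ.* dirX t
  edge-order {t} {t'} e e' L'<R = ℤP.0≤i-j⇒j≤i (ℤP.*-cancelʳ-≤-pos 0ℤ gap (+ suc δ) (begin
    0ℤ                                          ≤⟨ ℤP.+-mono-≤ (0≤dirX* t' lowerʳ) (0≤dirX* t lowerˡ) ⟩
    dirX t' ℤ.* Δ t L' R ℤ.+ dirX t ℤ.* Δ t' R L'
      ≡⟨ cross (dirX t) (dirY t) (dirX t') (dirY t') (+ col R) (+ row R) (+ col L') (+ row L') ⟩
    gap ℤ.* (+ col R ℤ.- + col L')              ≡⟨ cong (gap ℤ.*_) Δx ⟩
    gap ℤ.* + suc δ                              ∎))
    where
    open ℤP.≤-Reasoning
    R = right e
    L' = left e'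
    gap = dirY t' ℤ.* dirX t ℤ.- dirY t ℤ.* dirX t'
    Δ : Slope → Point → Point → ℤ
    Δ t p q = labelAt t p ℤ.- labelAt t q
    lowerʳ : 0ℤ ℤ.≤ Δ t L' R
    lowerʳ = ℤP.i≤j⇒0≤j-i (subst (ℤ._≤ labelAt t L') (same-line e) (left-lowest e L' (left-support e')))
    lowerˡ : 0ℤ ℤ.≤ Δ t' R L'
    lowerˡ = ℤP.i≤j⇒0≤j-i (left-lowest e' R (right-support e))
    δ = proj₁ (ℕP.m≤n⇒∃[o]m+o≡n L'<R)
    Δx : + col R ℤ.- + col L' ≡ + suc δ
    Δx = subst (λ x → + x ℤ.- + col L' ≡ + suc δ)
           (trans (ℕP.+-suc (col L') δ) (proj₂ (ℕP.m≤n⇒∃[o]m+o≡n L'<R))) ([a+p]-a≡p (col L') (suc δ))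
    cross : ∀ a b a' b' x y x' y' →
      a' ℤ.* ((b ℤ.* x' ℤ.- a ℤ.* y') ℤ.- (b ℤ.* x ℤ.- a ℤ.* y)) ℤ.+
      a ℤ.* ((b' ℤ.* x ℤ.- a' ℤ.* y) ℤ.- (b' ℤ.* x' ℤ.- a' ℤ.* y'))
      ≡ (b' ℤ.* a ℤ.- b ℤ.* a') ℤ.* (x ℤ.- x')
    cross = solve-∀

  edges-apart : ∀ {t t'} (e : Edge t) (e' : Edge t') → t ≢ t' →
    col (right e) ≤ col (left e') ⊎ col (right e') ≤ col (left e)
  edges-apart {t} {t'} e e' t≢t' with col (right e) ℕP.≤? col (left e') | col (right e') ℕP.≤? col (left e)
  ... | yes R≤L' | _ = inj₁ R≤L'
  ... | no _ | yes R'≤L = inj₂ R'≤L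
  ... | no R≰L' | no R'≰L = ⊥-elim (t≢t' (parallel⇒≡ t t'
    (ℤP.≤-antisym (edge-order e e' (ℕP.≰⇒> R≰L')) (edge-order e' e (ℕP.≰⇒> R'≰L)))))

  private
    leftCol edgeRun : ∃ Edge → ℕ
    leftCol (_ , e) = col (left e)
    edgeRun (t , _) = run t

    map-proj₁-toList : ∀ {ts} (es : All Edge ts) → map proj₁ (All.toList es) ≡ ts
    map-proj₁-toList [] = refl
    map-proj₁-toList (e ∷ es) = cong (_ ∷_) (map-proj₁-toList es)

  runs<n : ∀ ts → Unique ts → All (λ t → Balanced t Z) ts → ∀ p → Support p → runs ts < n
  runs<n ts unique balanced p sp = ℕP.≤-<-trans (begin
    runs ts
      ≡⟨ cong sum (sym (trans (LP.map-∘ edges) (cong (map run) (map-proj₁-toList edgesOfTs)))) ⟩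
    sum (map edgeRun edges)
      ≤⟨ apart-packing leftCol edgeRun (length edges) edges ℕP.≤-refl z≤n apart inside ⟩
    ℕ.pred n ∎) (pred<n (proj₁ p))
    where
    open ℕP.≤-Reasoning
    edgesOfTs : All Edge ts
    edgesOfTs = All.map (λ {t} bal → edge t bal p sp) balanced
    edges = All.toList edgesOfTs
    apart : AllPairs (Apart leftCol edgeRun) edges
    apart = AP.map (λ {(t , e)} {(t' , e')} t≢t' →
                     [ (λ R≤L' → inj₁ (ℕP.≤-trans (wide e) R≤L')) , (λ R'≤L → inj₂ (ℕP.≤-trans (wide e') R'≤L)) ]′
                     (edges-apart e e' t≢t'))
              (APP.map⁻ (subst Unique (sym (map-proj₁-toList edgesOfTs)) unique))
    inside : All (λ a → 0 ≤ leftCol a × leftCol a ℕ.+ edgeRun a ≤ ℕ.pred n) edges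
    inside = All.tabulate (λ {(t , e)} _ → z≤n , ℕP.≤-trans (wide e) (FinP.toℕ≤pred[n] (proj₁ (right e))))

runs-reciprocal : ∀ ts → runs (map reciprocal ts) ≡ rises ts
runs-reciprocal ts = cong sum (trans (sym (LP.map-∘ ts)) (LP.map-cong run-reciprocal ts))

kernel-bounds : ∀ {n m} (Z : Assignment n m) ts → Unique ts → All (λ t → Balanced t Z) ts →
  ∀ i j → Z i j ≢ 0ℚ → runs ts < n × rises ts < m
kernel-bounds Z ts unique balanced i j nz =
  runs<n Z ts unique balanced (i , j) nz ,
  subst (_< _) (runs-reciprocal ts)
    (runs<n (transpose Z) (map reciprocal ts)
      (UniqueP.map⁺ reciprocal-injective unique)
      (AllP.map⁺ (All.map (λ {t} → Balanced-transpose t) balanced)) (j , i) nz)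
  where
  reciprocal-injective : ∀ {t t'} → reciprocal t ≡ reciprocal t' → t ≡ t'
  reciprocal-injective {t} {t'} eq =
    trans (sym (reciprocal-involutive t)) (trans (cong reciprocal eq) (reciprocal-involutive t'))

Saturated : ℕ → ℕ → Slope → Set
Saturated n m s = n ≤ runs (slopesUpTo s) ⊎ m ≤ rises (slopesUpTo s)

solution-difference : ∀ {n m s c X Y} → IsSolution n m s c X → IsSolution n m s c Y →
  All (λ t → Balanced t (λ i j → X i j ℚ.- Y i j)) (slopesUpTo s)
solution-difference {s = s} {c} {X} {Y} solX solY =
  All.map (λ {t} t<s → balanced t (ℕP.≤-pred t<s)) (slopesBelow-rank (suc (rank s)))
  where
  balanced : ∀ t → t ⪯ s → Balanced t (λ i j → X i j ℚ.- Y i j)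
  balanced t t⪯s i j =
    trans (lineSum-distrib-sub t (label t i j) X Y)
          (trans (cong₂ ℚ._-_ (solX t t⪯s i j) (solY t t⪯s i j)) (ℚP.+-inverseʳ (c t (label t i j))))

saturated⇒unique : ∀ {n m} s → Saturated n m s → Kprop n m s
saturated⇒unique {n} {m} s saturated c _ X Y solX solY i j _ =
  x-y≡0⇒x≡y (X i j) (Y i j) (decidable-stable (X i j ℚ.- Y i j ℚP.≟ 0ℚ) (λ X-Y≢0 →
    let runs< , rises< = kernel-bounds Z (slopesUpTo s) (slopesBelow-unique _)
                                       (solution-difference {n} {m} {s} {c} {X} {Y} solX solY) i j X-Y≢0
    in [ ℕP.<⇒≱ runs< , ℕP.<⇒≱ rises< ]′ saturated))
  where
  Z : Assignment n m
  Z i j = X i j ℚ.- Y i j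

-- Non-uniqueness below saturation: ghosts

posPart negPart : ℤ → ℕ
posPart (+ k) = k
posPart -[1+ k ] = 0
negPart (+ k) = 0
negPart -[1+ k ] = suc k

posPart-negPart : ∀ i → i ≡ + posPart i ℤ.- + negPart i
posPart-negPart (+ k) = sym (ℤP.+-identityʳ (+ k))
posPart-negPart -[1+ k ] = refl

∣∣≡posPart+negPart : ∀ i → ℤ.∣ i ∣ ≡ posPart i ℕ.+ negPart i
∣∣≡posPart+negPart (+ k) = sym (ℕP.+-identityʳ k)
∣∣≡posPart+negPart -[1+ k ] = refl

rise⁺ rise⁻ : Slope → ℕ
rise⁺ t = posPart (dirY t)
rise⁻ t = negPart (dirY t)

rise⁺≤rise : ∀ t → rise⁺ t ≤ rise t
rise⁺≤rise t = ℕP.≤-trans (ℕP.m≤m+n _ _) (ℕP.≤-reflexive (sym (∣∣≡posPart+negPart (dirY t))))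

rise⁻≤rise : ∀ t → rise⁻ t ≤ rise t
rise⁻≤rise t = ℕP.≤-trans (ℕP.m≤n+m _ _) (ℕP.≤-reflexive (sym (∣∣≡posPart+negPart (dirY t))))

δ₀ : ℤ → ℤ → ℚ
δ₀ (+ 0) (+ 0) = 1ℚ
δ₀ _ _ = 0ℚ

-- Coefficients of ∏_{t ∈ ts} (x^{run t} y^{rise⁺ t} − y^{rise⁻ t}); both monomials of the
-- factor of t lie on one line of slope t, so that factor has zero line sums along t.
ghost : List Slope → ℤ → ℤ → ℚ
ghost [] = δ₀
ghost (t ∷ ts) x y = ghost ts (x ℤ.- + run t) (y ℤ.- + rise⁺ t) ℚ.- ghost ts x (y ℤ.- + rise⁻ t)

Within : ℕ → ℤ → Set
Within A x = ∃ λ p → p ≤ A × x ≡ + p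

Within-shift : ∀ {A a a' x} → a ≤ a' → Within A (x ℤ.- + a) → Within (a' ℕ.+ A) x
Within-shift {A} {a} {a'} {x} a≤a' (p , p≤A , x-a≡p) = a ℕ.+ p , ℕP.+-mono-≤ a≤a' p≤A ,
  x-a≡p⇒x≡a+p x a p x-a≡p

ghost-support : ∀ ts x y → ghost ts x y ≢ 0ℚ → Within (runs ts) x × Within (rises ts) y
ghost-support [] (+ 0) (+ 0) _ = (0 , z≤n , refl) , (0 , z≤n , refl)
ghost-support [] (+ 0) (+ suc _) nz = ⊥-elim (nz refl)
ghost-support [] (+ 0) -[1+ _ ] nz = ⊥-elim (nz refl)
ghost-support [] (+ suc _) _ nz = ⊥-elim (nz refl)
ghost-support [] -[1+ _ ] _ nz = ⊥-elim (nz refl)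
ghost-support (t ∷ ts) x y nz with ghost ts (x ℤ.- + run t) (y ℤ.- + rise⁺ t) ℚP.≟ 0ℚ
... | no head≢0 = let wx , wy = ghost-support ts _ _ head≢0
                  in Within-shift ℕP.≤-refl wx , Within-shift (rise⁺≤rise t) wy
... | yes head≡0 = let wx , wy = ghost-support ts x _ tail≢0
                   in Within-shift z≤n (subst (Within _) (sym (ℤP.+-identityʳ x)) wx) , Within-shift (rise⁻≤rise t) wy
  where
  tail≢0 : ghost ts x (y ℤ.- + rise⁻ t) ≢ 0ℚ
  tail≢0 tail≡0 = nz (cong₂ ℚ._-_ head≡0 tail≡0)

translate : ∀ {n m} → (ℤ → ℤ → ℚ) → ℕ → ℕ → Assignment n m
translate G u w i j = G (+ toℕ i ℤ.- + u) (+ toℕ j ℤ.- + w)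

BoxSupported : ℕ → ℕ → (ℤ → ℤ → ℚ) → Set
BoxSupported A B G = ∀ x y → G x y ≢ 0ℚ → Within A x × Within B y

Within⇒bounds : ∀ {A u x} → Within A (+ x ℤ.- + u) → u ≤ x × x ≤ u ℕ.+ A
Within⇒bounds {A} {u} {x} (p , p≤A , x-u≡p) rewrite ℤP.+-injective (x-a≡p⇒x≡a+p (+ x) u p x-u≡p) =
  ℕP.m≤m+n u p , ℕP.+-monoʳ-≤ u p≤A

lineSum-translate : ∀ {n m} t d A B G u w → BoxSupported A B G → u ℕ.+ A < n → w ℕ.+ B < m →
  lineSum t d (translate {n} {m} G u w) ≡
  ∑ {suc A} (λ i → ∑ {suc B} (λ j →
    if ⌊ labelℤ t (+ (u ℕ.+ toℕ i)) (+ (w ℕ.+ toℕ j)) ℤP.≟ d ⌋ then G (+ toℕ i) (+ toℕ j) else 0ℚ))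
lineSum-translate {n} {m} t d A B G u w supported u+A<n w+B<m =
  trans (∑-window n u A (λ x → ∑ {m} (term x ∘ toℕ)) u+A<n column-support)
        (∑-cong {suc A} λ i → trans (∑-window m w B (term (u ℕ.+ toℕ i)) w+B<m (row-support (u ℕ.+ toℕ i)))
                            (∑-cong {suc B} λ j →
                              cong₂ (λ x y → if ⌊ labelℤ t (+ (u ℕ.+ toℕ i)) (+ (w ℕ.+ toℕ j)) ℤP.≟ d ⌋ then G x y else 0ℚ)
                                                ([a+p]-a≡p u (toℕ i)) ([a+p]-a≡p w (toℕ j))))
  where
  term : ℕ → ℕ → ℚ
  term x y = if ⌊ labelℤ t (+ x) (+ y) ℤP.≟ d ⌋ then G (+ x ℤ.- + u) (+ y ℤ.- + w) else 0ℚ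
  row-support : ∀ x y → term x y ≢ 0ℚ → w ≤ y × y ≤ w ℕ.+ B
  row-support x y nz = Within⇒bounds (proj₂ (supported _ _ (proj₂ (indicator≢0 _ nz))))
  column-support : ∀ x → ∑ {m} (term x ∘ toℕ) ≢ 0ℚ → u ≤ x × x ≤ u ℕ.+ A
  column-support x nz = let j , nzj = ∑-nonzero {m} (term x ∘ toℕ) nz
                        in Within⇒bounds (proj₁ (supported _ _ (proj₂ (indicator≢0 _ nzj))))

label-along : ∀ t x y → labelℤ t (x ℤ.+ + run t) (y ℤ.+ + rise⁺ t) ≡ labelℤ t x (y ℤ.+ + rise⁻ t)
label-along t x y = begin
  dirY t ℤ.* (x ℤ.+ a) ℤ.- dirX t ℤ.* (y ℤ.+ p)
    ≡⟨ cong₂ (λ b a' → b ℤ.* (x ℤ.+ a) ℤ.- a' ℤ.* (y ℤ.+ p)) b≡ (dirX≡run t) ⟩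
  (p ℤ.- q) ℤ.* (x ℤ.+ a) ℤ.- a ℤ.* (y ℤ.+ p)
    ≡⟨ along p q a x y ⟩
  (p ℤ.- q) ℤ.* x ℤ.- a ℤ.* (y ℤ.+ q)
    ≡⟨ sym (cong₂ (λ b a' → b ℤ.* x ℤ.- a' ℤ.* (y ℤ.+ q)) b≡ (dirX≡run t)) ⟩
  dirY t ℤ.* x ℤ.- dirX t ℤ.* (y ℤ.+ q) ∎
  where
  open ≡-Reasoning
  a = + run t
  p = + rise⁺ t
  q = + rise⁻ t
  b≡ : dirY t ≡ p ℤ.- q
  b≡ = posPart-negPart (dirY t)
  along : ∀ p q a x y → (p ℤ.- q) ℤ.* (x ℤ.+ a) ℤ.- a ℤ.* (y ℤ.+ p) ≡ (p ℤ.- q) ℤ.* x ℤ.- a ℤ.* (y ℤ.+ q)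
  along = solve-∀

lineSum-translate-along : ∀ {n m} t d A B G u w → BoxSupported A B G →
  u ℕ.+ run t ℕ.+ A < n → w ℕ.+ rise⁺ t ℕ.+ B < m → w ℕ.+ rise⁻ t ℕ.+ B < m →
  lineSum t d (translate {n} {m} G (u ℕ.+ run t) (w ℕ.+ rise⁺ t)) ≡ lineSum t d (translate {n} {m} G u (w ℕ.+ rise⁻ t))
lineSum-translate-along t d A B G u w supported fits₁ˣ fits₁ʸ fits₂ʸ = begin
  _ ≡⟨ lineSum-translate t d A B G _ _ supported fits₁ˣ fits₁ʸ ⟩
  _ ≡⟨ ∑-cong {suc A} (λ i → ∑-cong {suc B} λ j →
         cong (λ l → if ⌊ l ℤP.≟ d ⌋ then G (+ toℕ i) (+ toℕ j) else 0ℚ) (begin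
           labelℤ t (+ (u ℕ.+ run t ℕ.+ toℕ i)) (+ (w ℕ.+ rise⁺ t ℕ.+ toℕ j))
             ≡⟨ cong₂ (labelℤ t) (shift u (run t) (toℕ i)) (shift w (rise⁺ t) (toℕ j)) ⟩
           labelℤ t (+ (u ℕ.+ toℕ i) ℤ.+ + run t) (+ (w ℕ.+ toℕ j) ℤ.+ + rise⁺ t)
             ≡⟨ label-along t (+ (u ℕ.+ toℕ i)) (+ (w ℕ.+ toℕ j)) ⟩
           labelℤ t (+ (u ℕ.+ toℕ i)) (+ (w ℕ.+ toℕ j) ℤ.+ + rise⁻ t)
             ≡⟨ cong (labelℤ t (+ (u ℕ.+ toℕ i))) (sym (shift w (rise⁻ t) (toℕ j))) ⟩
           labelℤ t (+ (u ℕ.+ toℕ i)) (+ (w ℕ.+ rise⁻ t ℕ.+ toℕ j)) ∎)) ⟩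
  _ ≡⟨ sym (lineSum-translate t d A B G _ _ supported fits₂ˣ fits₂ʸ) ⟩
  _ ∎
  where
  open ≡-Reasoning
  fits₂ˣ = ℕP.≤-<-trans (ℕP.+-monoˡ-≤ A (ℕP.m≤m+n u (run t))) fits₁ˣ
  shift : ∀ u a i → + (u ℕ.+ a ℕ.+ i) ≡ + (u ℕ.+ i) ℤ.+ + a
  shift u a i = trans (cong +_ (swap u a i)) (ℤP.pos-+ (u ℕ.+ i) a)
    where swap : ∀ u a i → u ℕ.+ a ℕ.+ i ≡ u ℕ.+ i ℕ.+ a
          swap = solve-∀ℕ

translate-ghost-∷ : ∀ {n m} t ts u w i j →
  translate {n} {m} (ghost (t ∷ ts)) u w i j ≡
  translate (ghost ts) (u ℕ.+ run t) (w ℕ.+ rise⁺ t) i j ℚ.- translate (ghost ts) u (w ℕ.+ rise⁻ t) i j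
translate-ghost-∷ t ts u w i j =
  cong₂ ℚ._-_ (cong₂ (ghost ts) (sub-sub (+ toℕ i) u (run t)) (sub-sub (+ toℕ j) w (rise⁺ t)))
              (cong (ghost ts (+ toℕ i ℤ.- + u)) (sub-sub (+ toℕ j) w (rise⁻ t)))
  where
  sub-sub : ∀ x a b → x ℤ.- + a ℤ.- + b ≡ x ℤ.- + (a ℕ.+ b)
  sub-sub x a b = trans (sub-sub′ x (+ a) (+ b)) (cong (λ c → x ℤ.- c) (sym (ℤP.pos-+ a b)))
    where sub-sub′ : ∀ x a b → x ℤ.- a ℤ.- b ≡ x ℤ.- (a ℤ.+ b)
          sub-sub′ = solve-∀

shrink-fit : ∀ {v a a' A N} → a ≤ a' → v ℕ.+ (a' ℕ.+ A) < N → v ℕ.+ a ℕ.+ A < N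
shrink-fit {v} {a} {a'} {A} a≤a' = ℕP.≤-<-trans
  (ℕP.≤-trans (ℕP.≤-reflexive (ℕP.+-assoc v a A)) (ℕP.+-monoʳ-≤ v (ℕP.+-monoˡ-≤ A a≤a')))

ghost-balanced : ∀ {n m} ts u w → u ℕ.+ runs ts < n → w ℕ.+ rises ts < m →
  ∀ t → t ∈ ts → ∀ d → lineSum t d (translate {n} {m} (ghost ts) u w) ≡ 0ℚ
ghost-balanced {n} {m} (t' ∷ ts) u w fitsˣ fitsʸ t t∈ d = begin
  lineSum t d (translate {n} {m} (ghost (t' ∷ ts)) u w) ≡⟨ lineSum-cong {n} {m} t d (translate-ghost-∷ t' ts u w) ⟩
  lineSum t d (λ i j → P₁ i j ℚ.- P₂ i j)              ≡⟨ lineSum-distrib-sub t d P₁ P₂ ⟩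
  lineSum t d P₁ ℚ.- lineSum t d P₂                     ≡⟨ cancel t∈ ⟩
  0ℚ                                                    ∎
  where
  open ≡-Reasoning
  P₁ P₂ : Assignment n m
  P₁ = translate (ghost ts) (u ℕ.+ run t') (w ℕ.+ rise⁺ t')
  P₂ = translate (ghost ts) u (w ℕ.+ rise⁻ t')
  fits₁ˣ : u ℕ.+ run t' ℕ.+ runs ts < n
  fits₁ˣ = shrink-fit {u} {run t'} {run t'} {runs ts} ℕP.≤-refl fitsˣ
  fits₁ʸ : w ℕ.+ rise⁺ t' ℕ.+ rises ts < m
  fits₁ʸ = shrink-fit {w} {rise⁺ t'} {rise t'} {rises ts} (rise⁺≤rise t') fitsʸ
  fits₂ˣ : u ℕ.+ runs ts < n
  fits₂ˣ = ℕP.≤-<-trans (ℕP.+-monoʳ-≤ u (ℕP.m≤n+m (runs ts) (run t'))) fitsˣ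
  fits₂ʸ : w ℕ.+ rise⁻ t' ℕ.+ rises ts < m
  fits₂ʸ = shrink-fit {w} {rise⁻ t'} {rise t'} {rises ts} (rise⁻≤rise t') fitsʸ
  cancel : t ∈ t' ∷ ts → lineSum t d P₁ ℚ.- lineSum t d P₂ ≡ 0ℚ
  cancel (here refl) =
    trans (cong (λ s → lineSum t' d P₁ ℚ.- s)
                (sym (lineSum-translate-along t' d _ _ (ghost ts) u w (ghost-support ts) fits₁ˣ fits₁ʸ fits₂ʸ)))
          (ℚP.+-inverseʳ (lineSum t' d P₁))
  cancel (there t∈ts) = cong₂ ℚ._-_ (ghost-balanced ts (u ℕ.+ run t') (w ℕ.+ rise⁺ t') fits₁ˣ fits₁ʸ t t∈ts d)
                                    (ghost-balanced ts u (w ℕ.+ rise⁻ t') fits₂ˣ fits₂ʸ t t∈ts d)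

x-a<x : ∀ x {a} → 1 ≤ a → x ℤ.- + a ℤ.< x
x-a<x x {suc a} _ = subst (x ℤ.- + suc a ℤ.<_) (ℤP.+-identityʳ x) (ℤP.+-monoʳ-< x ℤ.-<+)

x<y+a⇒x-a<y : ∀ {x y} a → x ℤ.< y ℤ.+ + a → x ℤ.- + a ℤ.< y
x<y+a⇒x-a<y {x} {y} a x<y+a = subst (x ℤ.- + a ℤ.<_) (cancel y (+ a)) (ℤP.+-monoˡ-< (ℤ.- + a) x<y+a)
  where cancel : ∀ y a → y ℤ.+ a ℤ.- a ≡ y
        cancel = solve-∀

ghost-below : ∀ ts x y → y ℤ.< 0ℤ → ghost ts x y ≡ 0ℚ
ghost-below ts x y y<0 = ≢0-stable λ nz →
  let q , _ , y≡q = proj₂ (ghost-support ts x y nz)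
  in ℤP.<⇒≱ y<0 (subst (0ℤ ℤ.≤_) (sym y≡q) (ℤ.+≤+ z≤n))

-ℚ≢0 : ∀ {q} → q ≢ 0ℚ → ℚ.- q ≢ 0ℚ
-ℚ≢0 q≢0 -q≡0 = q≢0 (ℚP.neg-injective -q≡0)

data Tilt (t : Slope) : Set where
  rising  : 1 ≤ rise⁺ t → rise⁻ t ≡ 0 → Tilt t
  falling : rise⁺ t ≡ 0 → 1 ≤ rise⁻ t → Tilt t
  level   : rise⁺ t ≡ 0 → rise⁻ t ≡ 0 → 1 ≤ run t → Tilt t

tilt : ∀ t → Tilt t
tilt zeroS = level refl refl (s≤s z≤n)
tilt infS = rising (s≤s z≤n) refl
tilt negOne = falling refl (s≤s z≤n)
tilt posOne = rising (s≤s z≤n) refl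
tilt (negInv k) = falling refl (s≤s z≤n)
tilt (negInt k) = falling refl (s≤s z≤n)
tilt (posInv k) = rising (s≤s z≤n) refl
tilt (posInt k) = rising (s≤s z≤n) refl

ghost-bottom : ∀ ts → ∃ λ x₀ → ghost ts x₀ 0ℤ ≢ 0ℚ × (∀ x → x ℤ.< x₀ → ghost ts x 0ℤ ≡ 0ℚ)
ghost-bottom [] = 0ℤ , (λ ()) , left-of-origin
  where
  left-of-origin : ∀ x → x ℤ.< 0ℤ → δ₀ x 0ℤ ≡ 0ℚ
  left-of-origin -[1+ _ ] _ = refl
  left-of-origin (+ _) (ℤ.+<+ ())
ghost-bottom (t ∷ ts) with ghost-bottom ts | tilt t
... | x₀ , nz , left | rising r⁺≥1 r⁻≡0 =
  x₀ , (λ eq → -ℚ≢0 nz (trans (sym (value x₀)) eq)) , (λ x x<x₀ → trans (value x) (cong ℚ.-_ (left x x<x₀)))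
  where
  value : ∀ x → ghost (t ∷ ts) x 0ℤ ≡ ℚ.- ghost ts x 0ℤ
  value x = trans (cong₂ ℚ._-_ (ghost-below ts _ _ (x-a<x 0ℤ r⁺≥1)) (cong (λ k → ghost ts x (0ℤ ℤ.- + k)) r⁻≡0))
                  (ℚP.+-identityˡ _)
... | x₀ , nz , left | falling r⁺≡0 r⁻≥1 =
  x₀ ℤ.+ + run t ,
  (λ eq → nz (trans (cong (λ x → ghost ts x 0ℤ) (sym (cancel x₀ (+ run t)))) (trans (sym (value _)) eq))) ,
  (λ x x<x₀+a → trans (value x) (left _ (x<y+a⇒x-a<y (run t) x<x₀+a)))
  where
  cancel : ∀ y a → y ℤ.+ a ℤ.- a ≡ y
  cancel = solve-∀
  value : ∀ x → ghost (t ∷ ts) x 0ℤ ≡ ghost ts (x ℤ.- + run t) 0ℤ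
  value x = trans (cong₂ ℚ._-_ (cong (λ k → ghost ts (x ℤ.- + run t) (0ℤ ℤ.- + k)) r⁺≡0)
                               (ghost-below ts x _ (x-a<x 0ℤ r⁻≥1)))
                  (ℚP.+-identityʳ _)
... | x₀ , nz , left | level r⁺≡0 r⁻≡0 run≥1 =
  x₀ , (λ eq → -ℚ≢0 nz (trans (sym at-x₀) eq)) ,
  (λ x x<x₀ → trans (value x) (cong₂ ℚ._-_ (left _ (ℤP.<-trans (x-a<x x run≥1) x<x₀)) (left x x<x₀)))
  where
  value : ∀ x → ghost (t ∷ ts) x 0ℤ ≡ ghost ts (x ℤ.- + run t) 0ℤ ℚ.- ghost ts x 0ℤ
  value x = cong₂ ℚ._-_ (cong (λ k → ghost ts (x ℤ.- + run t) (0ℤ ℤ.- + k)) r⁺≡0)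
                        (cong (λ k → ghost ts x (0ℤ ℤ.- + k)) r⁻≡0)
  at-x₀ : ghost (t ∷ ts) x₀ 0ℤ ≡ ℚ.- ghost ts x₀ 0ℤ
  at-x₀ = trans (value x₀) (trans (cong (ℚ._- ghost ts x₀ 0ℤ) (left _ (x-a<x x₀ run≥1))) (ℚP.+-identityˡ _))

ghost-cons-rotated : ∀ t ts x y →
  ghost (t ∷ ts) (+ runs (t ∷ ts) ℤ.- x) (+ rises (t ∷ ts) ℤ.- y) ≡
  ghost ts (+ runs ts ℤ.- x) (+ rises ts ℤ.- (y ℤ.- + rise⁻ t)) ℚ.-
  ghost ts (+ runs ts ℤ.- (x ℤ.- + run t)) (+ rises ts ℤ.- (y ℤ.- + rise⁺ t))
ghost-cons-rotated t ts x y =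
  cong₂ ℚ._-_ (cong₂ (ghost ts) (trans (cong (λ z → z ℤ.- x ℤ.- a) runs≡) (e₁ a A x))
                                (trans (cong (λ z → z ℤ.- y ℤ.- p) rises≡) (e₂ p q B y)))
              (cong₂ (ghost ts) (trans (cong (ℤ._- x) runs≡) (e₃ a A x))
                                (trans (cong (λ z → z ℤ.- y ℤ.- q) rises≡) (e₄ p q B y)))
  where
  a = + run t
  p = + rise⁺ t
  q = + rise⁻ t
  A = + runs ts
  B = + rises ts
  runs≡ : + runs (t ∷ ts) ≡ a ℤ.+ A
  runs≡ = ℤP.pos-+ (run t) (runs ts)
  rises≡ : + rises (t ∷ ts) ≡ p ℤ.+ q ℤ.+ B
  rises≡ = trans (cong (λ r → + (r ℕ.+ rises ts)) (∣∣≡posPart+negPart (dirY t)))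
                 (trans (ℤP.pos-+ (rise⁺ t ℕ.+ rise⁻ t) (rises ts)) (cong (ℤ._+ B) (ℤP.pos-+ (rise⁺ t) (rise⁻ t))))
  e₁ : ∀ a A x → a ℤ.+ A ℤ.- x ℤ.- a ≡ A ℤ.- x
  e₁ = solve-∀
  e₂ : ∀ p q B y → p ℤ.+ q ℤ.+ B ℤ.- y ℤ.- p ≡ B ℤ.- (y ℤ.- q)
  e₂ = solve-∀
  e₃ : ∀ a A x → a ℤ.+ A ℤ.- x ≡ A ℤ.- (x ℤ.- a)
  e₃ = solve-∀
  e₄ : ∀ p q B y → p ℤ.+ q ℤ.+ B ℤ.- y ℤ.- q ≡ B ℤ.- (y ℤ.- p)
  e₄ = solve-∀

ghost-rotate : ∀ ts →
  (∀ x y → ghost ts (+ runs ts ℤ.- x) (+ rises ts ℤ.- y) ≡ ghost ts x y) ⊎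
  (∀ x y → ghost ts (+ runs ts ℤ.- x) (+ rises ts ℤ.- y) ≡ ℚ.- ghost ts x y)
ghost-rotate [] = inj₁ rotate-δ₀
  where
  rotate-δ₀ : ∀ x y → δ₀ (0ℤ ℤ.- x) (0ℤ ℤ.- y) ≡ δ₀ x y
  rotate-δ₀ (+ 0) (+ 0) = refl
  rotate-δ₀ (+ 0) (+ suc _) = refl
  rotate-δ₀ (+ 0) -[1+ _ ] = refl
  rotate-δ₀ (+ suc _) _ = refl
  rotate-δ₀ -[1+ _ ] _ = refl
ghost-rotate (t ∷ ts) with ghost-rotate ts
... | inj₁ same = inj₂ λ x y → trans (ghost-cons-rotated t ts x y)
  (trans (cong₂ ℚ._-_ (same x (y ℤ.- + rise⁻ t)) (same (x ℤ.- + run t) (y ℤ.- + rise⁺ t)))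
         (flip-sub (ghost ts x (y ℤ.- + rise⁻ t)) (ghost ts (x ℤ.- + run t) (y ℤ.- + rise⁺ t))))
  where
  flip-sub : ∀ a b → a ℚ.- b ≡ ℚ.- (b ℚ.- a)
  flip-sub a b = sym (neg-[x-y]≡y-x b a)
... | inj₂ negated = inj₁ λ x y → trans (ghost-cons-rotated t ts x y)
  (trans (cong₂ ℚ._-_ (negated x (y ℤ.- + rise⁻ t)) (negated (x ℤ.- + run t) (y ℤ.- + rise⁺ t)))
         (neg-sub (ghost ts x (y ℤ.- + rise⁻ t)) (ghost ts (x ℤ.- + run t) (y ℤ.- + rise⁺ t))))
  where
  neg-sub : ∀ a b → ℚ.- a ℚ.- ℚ.- b ≡ b ℚ.- a
  neg-sub a b = trans (cong (ℚ.- a ℚ.+_) (neg-involutive b)) (ℚP.+-comm (ℚ.- a) b)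

on-grid : ∀ ts x y → ghost ts x y ≢ 0ℚ → ∃ λ p → x ≡ + p × ghost ts (+ p) y ≢ 0ℚ
on-grid ts x y nz with proj₁ (ghost-support ts x y nz)
... | p , _ , refl = p , refl , nz

ghost-bottom-row : ∀ ts → ∃ λ p → ghost ts (+ p) 0ℤ ≢ 0ℚ
ghost-bottom-row ts =
  let x₀ , nz , _ = ghost-bottom ts
      p , _ , nz' = on-grid ts x₀ 0ℤ nz
  in p , nz'

ghost-top-row : ∀ ts → ∃ λ p → ghost ts (+ p) (+ rises ts) ≢ 0ℚ
ghost-top-row ts =
  let x₀ , nz , _ = ghost-bottom ts
      p , _ , nz' = on-grid ts (+ runs ts ℤ.- x₀) (+ rises ts) (nz ∘ rotated x₀)
  in p , nz'
  where
  rotated : ∀ x₀ → ghost ts (+ runs ts ℤ.- x₀) (+ rises ts) ≡ 0ℚ → ghost ts x₀ 0ℤ ≡ 0ℚ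
  rotated x₀ eq with ghost-rotate ts
  ... | inj₁ same = trans (sym (same x₀ 0ℤ)) (trans (cong (ghost ts _) (ℤP.+-identityʳ _)) eq)
  ... | inj₂ negated = ℚP.neg-injective (trans (sym (negated x₀ 0ℤ)) (trans (cong (ghost ts _) (ℤP.+-identityʳ _)) eq))

Ambiguous : (n m : ℕ) → List Slope → (Fin n → Fin m → Set) → Set
Ambiguous n m ts A = ∃ λ (X : Assignment n m) → All (λ t → Balanced t X) ts × ∃₂ λ i j → A i j × X i j ≢ 0ℚ

ghost-ambiguous : ∀ {n m} ts u w → u ℕ.+ runs ts < n → w ℕ.+ rises ts < m →
  ∀ p q → ghost ts (+ p) (+ q) ≢ 0ℚ → (A : Fin n → Fin m → Set) →
  (∀ {i j} → toℕ i ≡ u ℕ.+ p → toℕ j ≡ w ℕ.+ q → A i j) → Ambiguous n m ts A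
ghost-ambiguous {n} {m} ts u w fitsˣ fitsʸ p q nz A A-at =
  translate (ghost ts) u w ,
  All.tabulate (λ {t} t∈ i j → ghost-balanced ts u w fitsˣ fitsʸ t t∈ (label t i j)) ,
  i , j , A-at (FinP.toℕ-fromℕ< u+p<n) (FinP.toℕ-fromℕ< w+q<m) ,
  subst₂ (λ x y → ghost ts x y ≢ 0ℚ) (sym (recentre u p (FinP.toℕ-fromℕ< u+p<n)))
                                      (sym (recentre w q (FinP.toℕ-fromℕ< w+q<m))) nz
  where
  within : ∀ {A x} → Within A (+ x) → x ≤ A
  within (_ , x≤A , refl) = x≤A
  u+p<n : u ℕ.+ p < n
  u+p<n = ℕP.≤-<-trans (ℕP.+-monoʳ-≤ u (within (proj₁ (ghost-support ts _ _ nz)))) fitsˣ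
  w+q<m : w ℕ.+ q < m
  w+q<m = ℕP.≤-<-trans (ℕP.+-monoʳ-≤ w (within (proj₂ (ghost-support ts _ _ nz)))) fitsʸ
  i = Fin.fromℕ< u+p<n
  j = Fin.fromℕ< w+q<m
  recentre : ∀ u p {k} → k ≡ u ℕ.+ p → + k ℤ.- + u ≡ + p
  recentre u p refl = [a+p]-a≡p u p

ambiguous-firstRow : ∀ {n m} ts → runs ts < n → rises ts < m → Ambiguous n m ts firstRow
ambiguous-firstRow ts runs<n rises<m =
  let p , nz = ghost-bottom-row ts
  in ghost-ambiguous ts 0 0 runs<n rises<m p 0 nz firstRow (λ _ j≡0 → j≡0)

ambiguous-lastRow : ∀ {n m} ts → runs ts < n → rises ts < m → Ambiguous n m ts lastRow
ambiguous-lastRow {m = suc m'} ts runs<n rises<m =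
  let p , nz = ghost-top-row ts
  in ghost-ambiguous ts 0 (m' ∸ rises ts) runs<n (s≤s (ℕP.≤-reflexive top)) p (rises ts) nz lastRow
       (λ _ j≡ → cong suc (trans j≡ top))
  where
  top : m' ∸ rises ts ℕ.+ rises ts ≡ m'
  top = ℕP.m∸n+n≡m (ℕP.≤-pred rises<m)

ambiguous-transpose : ∀ {n m} ts {A : Fin m → Fin n → Set} →
  Ambiguous m n (map reciprocal ts) A → Ambiguous n m ts (λ i j → A j i)
ambiguous-transpose ts (X , balanced , j , i , a , nz) =
  transpose X ,
  All.map (λ {t} bal → subst (λ t' → Balanced t' (transpose X)) (reciprocal-involutive t)
                             (Balanced-transpose (reciprocal t) bal))
          (AllP.map⁻ balanced) ,
  i , j , a , nz

zero-balanced : ∀ {n m} t → Balanced {n} {m} t (λ _ _ → 0ℚ)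
zero-balanced {n} {m} t i j = ∑-zero {n} λ i' → ∑-zero {m} λ j' → if-zero ⌊ label t i' j' ℤP.≟ label t i j ⌋
  where
  if-zero : ∀ b → (if b then 0ℚ else 0ℚ) ≡ 0ℚ
  if-zero true = refl
  if-zero false = refl

ambiguous⇒¬unique : ∀ {n m A} s → Ambiguous n m (slopesUpTo s) A →
  ¬ UniquelySolvable n m s (λ _ _ → 0ℚ) A
ambiguous⇒¬unique s (X , balanced , i , j , a , nz) unique =
  nz (unique X (λ _ _ → 0ℚ) (λ t t⪯s → All.lookup balanced (∈-slopesUpTo {s} {t} t⪯s)) (λ t _ → zero-balanced t) i j a)

saturated? : ∀ n m s → Dec (Saturated n m s)
saturated? n m s = (n ℕP.≤? runs (slopesUpTo s)) ⊎-dec (m ℕP.≤? rises (slopesUpTo s))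

unsaturated-bounds : ∀ {n m} s → ¬ Saturated n m s → runs (slopesUpTo s) < n × rises (slopesUpTo s) < m
unsaturated-bounds s unsaturated = ℕP.≰⇒> (unsaturated ∘ inj₁) , ℕP.≰⇒> (unsaturated ∘ inj₂)

zero-solvable : ∀ n m s → Solvable n m s (λ _ _ → 0ℚ)
zero-solvable n m s = (λ _ _ → 0ℚ) , λ t _ → zero-balanced t

R⇒saturated : ∀ {n m} s → Rprop n m s → Saturated n m s
R⇒saturated {n} {m} s rows = decidable-stable (saturated? n m s) λ unsaturated →
  let runs< , rises< = unsaturated-bounds s unsaturated
  in [ ambiguous⇒¬unique s (ambiguous-firstRow (slopesUpTo s) runs< rises<)
     , ambiguous⇒¬unique s (ambiguous-lastRow (slopesUpTo s) runs< rises<) ]′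
     (rows (λ _ _ → 0ℚ) (zero-solvable n m s))

rises-reciprocal : ∀ ts → rises (map reciprocal ts) ≡ runs ts
rises-reciprocal ts = cong sum (trans (sym (LP.map-∘ ts)) (LP.map-cong rise-reciprocal ts))
  where
  rise-reciprocal : ∀ t → rise (reciprocal t) ≡ run t
  rise-reciprocal t = trans (sym (run-reciprocal (reciprocal t))) (cong run (reciprocal-involutive t))

C⇒saturated : ∀ {n m} s → Cprop n m s → Saturated n m s
C⇒saturated {n} {m} s columns = decidable-stable (saturated? n m s) λ unsaturated →
  let runs< , rises< = unsaturated-bounds s unsaturated
      runs<′ = subst (_< m) (sym (runs-reciprocal ts)) rises<
      rises<′ = subst (_< n) (sym (rises-reciprocal ts)) runs<
  in [ ambiguous⇒¬unique s (ambiguous-transpose ts (ambiguous-firstRow (map reciprocal ts) runs<′ rises<′))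
     , ambiguous⇒¬unique s (ambiguous-transpose ts (ambiguous-lastRow (map reciprocal ts) runs<′ rises<′)) ]′
     (columns (λ _ _ → 0ℚ) (zero-solvable n m s))
  where ts = slopesUpTo s

K⇒B : ∀ {n m} s → Kprop n m s → Bprop n m s
K⇒B s unique c sol X Y solX solY i j _ = unique c sol X Y solX solY i j _

B⇒R : ∀ {n m} s → Bprop n m s → Rprop n m s
B⇒R s border c sol = inj₁ λ X Y solX solY i j first → border c sol X Y solX solY i j (inj₂ (inj₁ first))

B⇒C : ∀ {n m} s → Bprop n m s → Cprop n m s
B⇒C s border c sol = inj₁ λ X Y solX solY i j first → border c sol X Y solX solY i j (inj₁ (inj₁ first))

saturated-eventually : ∀ n m → Saturated n m (fromRank (n ℕ.+ m))
saturated-eventually n m = decidable-stable (saturated? n m θ) λ unsaturated →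
  let runs< , rises< = unsaturated-bounds θ unsaturated
  in ℕP.<⇒≱ (ℕP.+-mono-< runs< rises<) (ℕP.≤-trans (ℕP.n≤1+n _) enough)
  where
  θ = fromRank (n ℕ.+ m)
  enough : suc (n ℕ.+ m) ≤ runs (slopesUpTo θ) ℕ.+ rises (slopesUpTo θ)
  enough = subst (λ r → suc (n ℕ.+ m) ≤ runs (slopesBelow (suc r)) ℕ.+ rises (slopesBelow (suc r)))
                 (sym (rank-fromRank (n ℕ.+ m))) (runs+rises-slopesBelow (suc (n ℕ.+ m)))

least-saturated : ∀ n m → ∃ λ θ → IsLeast (Saturated n m) θ
least-saturated n m with FinP.¬∀⟶∃¬-smallest (suc (n ℕ.+ m)) (λ r → ¬ Saturated n m (fromRank (toℕ r)))
                           (λ r → ¬? (saturated? n m (fromRank (toℕ r))))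
                           (λ none → none (Fin.fromℕ (n ℕ.+ m)) saturated-at-n+m)
  where
  saturated-at-n+m : Saturated n m (fromRank (toℕ (Fin.fromℕ (n ℕ.+ m))))
  saturated-at-n+m = subst (Saturated n m ∘ fromRank) (sym (FinP.toℕ-fromℕ (n ℕ.+ m))) (saturated-eventually n m)
... | r , ¬¬saturated , below =
  fromRank (toℕ r) , decidable-stable (saturated? n m (fromRank (toℕ r))) ¬¬saturated , least
  where
  least : ∀ t → Saturated n m t → fromRank (toℕ r) ⪯ t
  least t saturated with toℕ r ℕP.≤? rank t
  ... | yes r≤t = subst (_≤ rank t) (sym (rank-fromRank (toℕ r))) r≤t
  ... | no r≰t = ⊥-elim (below (Fin.fromℕ< (ℕP.≰⇒> r≰t))
                          (subst (Saturated n m) (sym (trans (cong fromRank at) (fromRank-rank t))) saturated))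
    where
    at : toℕ (Fin.inject (Fin.fromℕ< (ℕP.≰⇒> r≰t))) ≡ rank t
    at = trans (FinP.toℕ-inject _) (FinP.toℕ-fromℕ< _)

IsLeast-cong : ∀ {P Q : Slope → Set} {θ} → (∀ t → P t → Q t) → (∀ t → Q t → P t) →
  IsLeast P θ → IsLeast Q θ
IsLeast-cong {θ = θ} P⇒Q Q⇒P (Pθ , least) = P⇒Q θ Pθ , λ t Qt → least t (Q⇒P t Qt)

minSlope-idem : ∀ s → s ≡ minSlope s s
minSlope-idem s with rank s ℕ.≤ᵇ rank s
... | true = refl
... | false = refl

corollary1 : (n m : ℕ) → 1 ≤ n → 1 ≤ m →
    ∃ λ r → ∃ λ c → ∃ λ k → ∃ λ b →
      IsLeast (Rprop n m) r × IsLeast (Cprop n m) c ×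
      IsLeast (Kprop n m) k × IsLeast (Bprop n m) b ×
      r ≡ c × c ≡ k × k ≡ b × b ≡ minSlope r c
corollary1 n m _ _ =
  θ , θ , θ , θ ,
  least-for (λ t sat → B⇒R t (K⇒B t (saturated⇒unique t sat))) R⇒saturated ,
  least-for (λ t sat → B⇒C t (K⇒B t (saturated⇒unique t sat))) C⇒saturated ,
  least-for saturated⇒unique (λ t unique → R⇒saturated t (B⇒R t (K⇒B t unique))) ,
  least-for (λ t sat → K⇒B t (saturated⇒unique t sat)) (λ t border → R⇒saturated t (B⇒R t border)) ,
  refl , refl , refl , minSlope-idem θ
  where
  θ = proj₁ (least-saturated n m)
  least-for : ∀ {Q} → (∀ t → Saturated n m t → Q t) → (∀ t → Q t → Saturated n m t) → IsLeast Q θ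
  least-for sat⇒Q Q⇒sat = IsLeast-cong sat⇒Q Q⇒sat (proj₂ (least-saturated n m))
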